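{- Let $(\alpha_L)_{L\ge 0},(\beta_L)_{L\ge0}$ be a Bailey pair relative to $a$ and $q^2$. Define sequences $(\alpha'_L)_{L\ge0},(\beta'_L)_{L\ge0}$ by \[ \alpha'_{2L}=(-1)^L b^L q^{L^2}\frac{(aq/b;q^2)_L}{(bq;q^2)_L}\,\alpha_L,\qquad \alpha'_{2L+1}=0, \] \[ \beta'_L=\frac{(b;q^2)_L}{(q;q)_L(b;q)_L(aq;q^2)_L}\sum_{r=0}^{\lfloor L/2\rfloor}\frac{(aq/b;q^2)_r(q^{ -L};q)_{2r}\,q^{2r}}{(q^{2-2L}/b;q^2)_r}\,\beta_r . \] Then $(\alpha',\beta')$ is a Bailey pair relative to $a$ and $q$.
   Context: For $n\ge 0$, $(x;p)_n=\prod_{i=0}^{n-1}(1-xp^i)$. Sequences $(\alpha_L)_{L\ge0}$, $(\beta_L)_{L\ge0}$ form a Bailey pair relative to $a$ and base $p$ if $\beta_L=\sum_{r=0}^{L}\frac{\alpha_r}{(p;p)_{L-r}(ap;p)_{L+r}}$ for all $L\ge 0$. Here $a,b,q$ are indeterminates (generic parameters). -}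

module Defs where

open import Level using (Level; _⊔_) renaming (suc to lsuc)
open import Data.Nat as ℕ using (ℕ; zero; suc; _∸_; ⌊_/2⌋)
open import Algebra.Bundles using (CommutativeRing)
open import Relation.Nullary using (¬_)
open import Data.Product using (_×_)

-- A field: a commutative ring with 0 ≠ 1 and a (total) inverse operation
-- which is a genuine multiplicative inverse on every nonzero element
-- (its value at 0 is irrelevant junk and never used under the hypotheses).
record Field (c ℓ : Level) : Set (lsuc (c ⊔ ℓ)) where
  field
    commutativeRing : CommutativeRing c ℓ
  open CommutativeRing commutativeRing public
  infix 9 _⁻¹
  field
    _⁻¹      : Carrier → Carrier
    ⁻¹-cong  : ∀ {x y} → x ≈ y → x ⁻¹ ≈ y ⁻¹
    inverseʳ : ∀ x → ¬ (x ≈ 0#) → x * x ⁻¹ ≈ 1#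
    0≉1      : ¬ (0# ≈ 1#)

module FieldDefs {c ℓ : Level} (F : Field c ℓ) where
  open Field F

  pow : Carrier → ℕ → Carrier
  pow x zero    = 1#
  pow x (suc n) = pow x n * x

  infixl 7 _÷_
  _÷_ : Carrier → Carrier → Carrier
  x ÷ y = x * y ⁻¹

  poch : Carrier → Carrier → ℕ → Carrier
  poch x p zero    = 1#
  poch x p (suc n) = poch x p n * (1# + - (x * pow p n))

  sumTo : ℕ → (ℕ → Carrier) → Carrier
  sumTo zero    f = f 0
  sumTo (suc n) f = sumTo n f + f (suc n)

  IsBaileyPair : Carrier → Carrier → (ℕ → Carrier) → (ℕ → Carrier) → Set ℓ
  IsBaileyPair a p α β =
    ∀ L → β L ≈ sumTo L (λ r → α r ÷ (poch p p (L ∸ r) * poch (a * p) p (L ℕ.+ r)))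

  -- interleave f (2L) = f L, interleave f (2L+1) = 0
  interleave : (ℕ → Carrier) → ℕ → Carrier
  interleave f zero          = f 0
  interleave f (suc zero)    = 0#
  interleave f (suc (suc n)) = interleave (λ k → f (suc k)) n

  alpha' : Carrier → Carrier → Carrier → (ℕ → Carrier) → ℕ → Carrier
  alpha' a b q α = interleave (λ L →
    (pow (- 1#) L * pow b L * pow q (L ℕ.* L) * poch ((a * q) ÷ b) (q * q) L
      ÷ poch (b * q) (q * q) L) * α L)

  -- β'_L = (b;q^2)_L / ((q;q)_L (b;q)_L (aq;q^2)_L)
  --        Σ_{r=0}^{⌊L/2⌋} (aq/b;q^2)_r (q^{-L};q)_{2r} q^{2r} / (q^{2-2L}/b;q^2)_r β_r
  -- with q^{-L} = (q⁻¹)^L and q^{2-2L} = q^2 (q⁻¹)^{2L}.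
  beta' : Carrier → Carrier → Carrier → (ℕ → Carrier) → ℕ → Carrier
  beta' a b q β L =
    (poch b (q * q) L ÷ (poch q q L * poch b q L * poch (a * q) (q * q) L))
    * sumTo ⌊ L /2⌋ (λ r →
        (poch ((a * q) ÷ b) (q * q) r * poch (pow (q ⁻¹) L) q (r ℕ.+ r) * pow q (r ℕ.+ r)
          ÷ poch ((q * q * pow (q ⁻¹) (L ℕ.+ L)) ÷ b) (q * q) r) * β r)

  -- genericity of (a, b, q): all denominators occurring are nonzero
  Generic : Carrier → Carrier → Carrier → Set ℓ
  Generic a b q =
    ¬ (q ≈ 0#) × ¬ (b ≈ 0#)
    × (∀ i → ¬ (1# + - pow q (suc i) ≈ 0#))
    × (∀ i → ¬ (1# + - (a * pow q (suc i)) ≈ 0#))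
    × (∀ i → ¬ (1# + - (b * pow q i) ≈ 0#))

-- Insert the Bailey relation for β_r into β'_L and exchange the two finite sums: the coefficient
-- of α_s becomes a terminating sum over r = s + k. For L = 2s + m it is a product of q-Pochhammer
-- symbols times
--   Σ_{k ≤ ⌊m/2⌋} (Aq/B;q²)_k (q⁻ᵐ;q)_{2k} q^{2k} / ((q²;q²)_k (Aq²;q²)_k (q^{2-2m}/B;q²)_k)
-- with A = aq⁴ˢ and B = bq²ˢ, and this sum equals (B;q)_m (Aq;q²)_m / ((B;q²)_m (Aq;q)_m).
-- The summation is proved by induction on m: the sum for m + 1 minus the ratio of closed forms
-- times the sum for m telescopes against a certificate that is a rational multiple of the summand
-- (the WZ method). Reversing the q-Pochhammer symbols in q⁻ᴸ and q^{2-2L}/b then turns the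
-- coefficient into that of α'_{2s} in the Bailey relation for (α', β') in base q; the odd
-- coefficients α'_{2s+1} vanish.

module Submission where

open import Defs
open import Algebra.Bundles using (CommutativeRing; RawRing)
open import Algebra.Solver.Ring.AlmostCommutativeRing using (fromCommutativeRing; _-Raw-AlmostCommutative⟶_)
open import Data.Integer as ℤ using (ℤ; +_; -[1+_]; _⊖_; sign; ∣_∣; _◃_)
import Data.Integer.Properties as ℤP
open import Data.Maybe using (Maybe; just; nothing)
open import Data.Nat as ℕ using (ℕ; zero; suc; _≤_; _<_; z≤n; s≤s; _∸_; ⌊_/2⌋)
import Data.Nat.Properties as ℕP
open import Data.Nat.Tactic.RingSolver using () renaming (solve-∀ to ℕ-solve-∀)
open import Data.Product using (proj₁; proj₂)
open import Data.Sign as Sign using (Sign)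
open import Relation.Binary.PropositionalEquality as ≡ using (_≡_)
open import Relation.Nullary using (yes; no)

-- The ring solver needs a coefficient ring mapped homomorphically into the carrier; ℤ works for
-- every commutative ring. The type-checking optimised _×_ makes ⟦ + 1 ⟧ᶻ reduce to 1#.
module IntegerCoefficientSolver {c ℓ} (R : CommutativeRing c ℓ) where
  open CommutativeRing R
  open import Algebra.Properties.Ring ring using (-0#≈0#; -‿+-comm; -‿involutive; -1*x≈-x; -‿distribʳ-*)
  open import Algebra.Properties.Semiring.Mult.TCOptimised semiring using (_×_; 1+×; ×-homo-+; ×1-homo-*)
  open import Algebra.Properties.CommutativeSemigroup +-commutativeSemigroup using () renaming (interchange to +-interchange)
  open import Algebra.Properties.CommutativeSemigroup *-commutativeSemigroup using () renaming (interchange to *-interchange)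
  open import Relation.Binary.Reasoning.Setoid setoid

  ⟦_⟧ᶻ : ℤ → Carrier
  ⟦ + n ⟧ᶻ     = n × 1#
  ⟦ -[1+ n ] ⟧ᶻ = - (suc n × 1#)

  ⊖-homo : ∀ m n → ⟦ m ⊖ n ⟧ᶻ ≈ m × 1# + - (n × 1#)
  ⊖-homo zero    zero    = sym (trans (+-congˡ -0#≈0#) (+-identityʳ _))
  ⊖-homo zero    (suc n) = sym (+-identityˡ _)
  ⊖-homo (suc m) zero    = sym (trans (+-congˡ -0#≈0#) (+-identityʳ _))
  ⊖-homo (suc m) (suc n) = begin
    ⟦ suc m ⊖ suc n ⟧ᶻ                       ≡⟨ ≡.cong ⟦_⟧ᶻ (ℤP.[1+m]⊖[1+n]≡m⊖n m n) ⟩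
    ⟦ m ⊖ n ⟧ᶻ                               ≈⟨ ⊖-homo m n ⟩
    m × 1# + - (n × 1#)                     ≈⟨ sym (+-identityˡ _) ⟩
    0# + (m × 1# + - (n × 1#))              ≈⟨ +-congʳ (sym (-‿inverseʳ 1#)) ⟩
    (1# + - 1#) + (m × 1# + - (n × 1#))     ≈⟨ +-interchange _ _ _ _ ⟩
    (1# + m × 1#) + (- 1# + - (n × 1#))     ≈⟨ +-cong (sym (1+× m 1#)) (trans (-‿+-comm 1# (n × 1#)) (-‿cong (sym (1+× n 1#)))) ⟩
    suc m × 1# + - (suc n × 1#)             ∎

  +-homo : ∀ i j → ⟦ i ℤ.+ j ⟧ᶻ ≈ ⟦ i ⟧ᶻ + ⟦ j ⟧ᶻ
  +-homo (+ m)     (+ n)     = ×-homo-+ 1# m n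
  +-homo (+ m)     -[1+ n ]  = ⊖-homo m (suc n)
  +-homo -[1+ m ]  (+ n)     = trans (⊖-homo n (suc m)) (+-comm _ _)
  +-homo -[1+ m ]  -[1+ n ]  = begin
    - (suc (suc (m ℕ.+ n)) × 1#)     ≡⟨ ≡.cong (λ k → - (suc k × 1#)) (≡.sym (ℕP.+-suc m n)) ⟩
    - ((suc m ℕ.+ suc n) × 1#)       ≈⟨ -‿cong (×-homo-+ 1# (suc m) (suc n)) ⟩
    - (suc m × 1# + suc n × 1#)      ≈⟨ sym (-‿+-comm _ _) ⟩
    - (suc m × 1#) + - (suc n × 1#)  ∎

  -‿homo : ∀ i → ⟦ ℤ.- i ⟧ᶻ ≈ - ⟦ i ⟧ᶻ
  -‿homo (+ zero)  = sym -0#≈0#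
  -‿homo (+ suc n) = refl
  -‿homo -[1+ n ]  = sym (-‿involutive _)

  ⟦_⟧ˢ : Sign → Carrier
  ⟦ Sign.+ ⟧ˢ = 1#
  ⟦ Sign.- ⟧ˢ = - 1#

  ⟦⟧ᶻ-via-sign : ∀ i → ⟦ i ⟧ᶻ ≈ ⟦ sign i ⟧ˢ * (∣ i ∣ × 1#)
  ⟦⟧ᶻ-via-sign (+ n)    = sym (*-identityˡ _)
  ⟦⟧ᶻ-via-sign -[1+ n ] = sym (-1*x≈-x _)

  ◃-homo : ∀ s n → ⟦ s ◃ n ⟧ᶻ ≈ ⟦ s ⟧ˢ * (n × 1#)
  ◃-homo s        zero    = sym (zeroʳ _)
  ◃-homo Sign.+ (suc n) = sym (*-identityˡ _)
  ◃-homo Sign.- (suc n) = sym (-1*x≈-x _)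

  sign-*-homo : ∀ s t → ⟦ s Sign.* t ⟧ˢ ≈ ⟦ s ⟧ˢ * ⟦ t ⟧ˢ
  sign-*-homo Sign.+ t      = sym (*-identityˡ _)
  sign-*-homo Sign.- Sign.+ = sym (*-identityʳ _)
  sign-*-homo Sign.- Sign.- = begin
    1#               ≈⟨ sym (-‿involutive 1#) ⟩
    - (- 1#)         ≈⟨ -‿cong (sym (-1*x≈-x 1#)) ⟩
    - (- 1# * 1#)    ≈⟨ -‿distribʳ-* _ _ ⟩
    - 1# * - 1#      ∎

  *-homo : ∀ i j → ⟦ i ℤ.* j ⟧ᶻ ≈ ⟦ i ⟧ᶻ * ⟦ j ⟧ᶻ
  *-homo i j = begin
    ⟦ (sign i Sign.* sign j) ◃ (∣ i ∣ ℕ.* ∣ j ∣) ⟧ᶻ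
      ≈⟨ ◃-homo (sign i Sign.* sign j) (∣ i ∣ ℕ.* ∣ j ∣) ⟩
    ⟦ sign i Sign.* sign j ⟧ˢ * ((∣ i ∣ ℕ.* ∣ j ∣) × 1#)
      ≈⟨ *-cong (sign-*-homo (sign i) (sign j)) (×1-homo-* ∣ i ∣ ∣ j ∣) ⟩
    (⟦ sign i ⟧ˢ * ⟦ sign j ⟧ˢ) * ((∣ i ∣ × 1#) * (∣ j ∣ × 1#))
      ≈⟨ *-interchange _ _ _ _ ⟩
    (⟦ sign i ⟧ˢ * (∣ i ∣ × 1#)) * (⟦ sign j ⟧ˢ * (∣ j ∣ × 1#))
      ≈⟨ sym (*-cong (⟦⟧ᶻ-via-sign i) (⟦⟧ᶻ-via-sign j)) ⟩
    ⟦ i ⟧ᶻ * ⟦ j ⟧ᶻ ∎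

  ℤ-rawRing : RawRing _ _
  ℤ-rawRing = record
    { Carrier = ℤ ; _≈_ = _≡_ ; _+_ = ℤ._+_ ; _*_ = ℤ._*_ ; -_ = ℤ.-_ ; 0# = + 0 ; 1# = + 1 }

  ℤ⟶R : ℤ-rawRing -Raw-AlmostCommutative⟶ fromCommutativeRing R
  ℤ⟶R = record
    { ⟦_⟧ = ⟦_⟧ᶻ ; +-homo = +-homo ; *-homo = *-homo ; -‿homo = -‿homo
    ; 0-homo = refl ; 1-homo = refl }

  ⟦⟧ᶻ-equal? : ∀ i j → Maybe (⟦ i ⟧ᶻ ≈ ⟦ j ⟧ᶻ)
  ⟦⟧ᶻ-equal? i j with i ℤ.≟ j
  ... | yes ≡.refl = just refl
  ... | no _       = nothing

  open import Algebra.Solver.Ring ℤ-rawRing (fromCommutativeRing R) ℤ⟶R ⟦⟧ᶻ-equal? public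
    using (solve; _:=_; con; _:+_; _:*_; _:-_; :-_)

module FieldArithmetic {c ℓ} (F : Field c ℓ) where
  open Field F public
  open FieldDefs F public
  open IntegerCoefficientSolver commutativeRing public using (solve; _:=_; con; _:+_; _:*_; _:-_; :-_)
  open import Algebra.Properties.Ring ring public using (-0#≈0#)
  open import Algebra.Properties.CommutativeSemigroup +-commutativeSemigroup public
    using () renaming (interchange to +-interchange)
  open import Algebra.Properties.CommutativeSemigroup *-commutativeSemigroup public
    using (x∙yz≈y∙xz)
  open import Relation.Binary.Reasoning.Setoid setoid public

  1≉0 : 1# ≉ 0#
  1≉0 e = 0≉1 (sym e)

  ≉0-resp : ∀ {x y} → x ≈ y → x ≉ 0# → y ≉ 0#
  ≉0-resp e x≉0 y≈0 = x≉0 (trans e y≈0)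

  ⁻¹-inverseʳ : ∀ {x} → x ≉ 0# → x * x ⁻¹ ≈ 1#
  ⁻¹-inverseʳ {x} = inverseʳ x

  ⁻¹-inverseˡ : ∀ {x} → x ≉ 0# → x ⁻¹ * x ≈ 1#
  ⁻¹-inverseˡ {x} x≉0 = trans (*-comm _ _) (inverseʳ x x≉0)

  ⁻¹-unique : ∀ {x y} → x ≉ 0# → x * y ≈ 1# → x ⁻¹ ≈ y
  ⁻¹-unique {x} {y} x≉0 xy≈1 = begin
    x ⁻¹              ≈⟨ sym (*-identityʳ _) ⟩
    x ⁻¹ * 1#         ≈⟨ *-congˡ (sym xy≈1) ⟩
    x ⁻¹ * (x * y)    ≈⟨ sym (*-assoc _ _ _) ⟩
    (x ⁻¹ * x) * y    ≈⟨ *-congʳ (⁻¹-inverseˡ x≉0) ⟩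
    1# * y            ≈⟨ *-identityˡ y ⟩
    y                 ∎

  *-cancelʳ : ∀ {x y z} → z ≉ 0# → x * z ≈ y * z → x ≈ y
  *-cancelʳ {x} {y} {z} z≉0 e = begin
    x                 ≈⟨ sym (*-identityʳ x) ⟩
    x * 1#            ≈⟨ *-congˡ (sym (⁻¹-inverseʳ z≉0)) ⟩
    x * (z * z ⁻¹)    ≈⟨ sym (*-assoc _ _ _) ⟩
    x * z * z ⁻¹      ≈⟨ *-congʳ e ⟩
    y * z * z ⁻¹      ≈⟨ *-assoc _ _ _ ⟩
    y * (z * z ⁻¹)    ≈⟨ *-congˡ (⁻¹-inverseʳ z≉0) ⟩
    y * 1#            ≈⟨ *-identityʳ y ⟩
    y                 ∎

  *-≉0 : ∀ {x y} → x ≉ 0# → y ≉ 0# → x * y ≉ 0#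
  *-≉0 {x} {y} x≉0 y≉0 xy≈0 = y≉0 (begin
    y                 ≈⟨ sym (*-identityˡ y) ⟩
    1# * y            ≈⟨ *-congʳ (sym (⁻¹-inverseˡ x≉0)) ⟩
    x ⁻¹ * x * y      ≈⟨ *-assoc _ _ _ ⟩
    x ⁻¹ * (x * y)    ≈⟨ *-congˡ xy≈0 ⟩
    x ⁻¹ * 0#         ≈⟨ zeroʳ _ ⟩
    0#                ∎)

  *-annihilˡ : ∀ {x y} → x ≈ 0# → x * y ≈ 0#
  *-annihilˡ e = trans (*-congʳ e) (zeroˡ _)

  *-annihilʳ : ∀ {x y} → y ≈ 0# → x * y ≈ 0#
  *-annihilʳ e = trans (*-congˡ e) (zeroʳ _)

  ⁻¹-distrib-* : ∀ {x y} → x ≉ 0# → y ≉ 0# → (x * y) ⁻¹ ≈ x ⁻¹ * y ⁻¹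
  ⁻¹-distrib-* {x} {y} x≉0 y≉0 = ⁻¹-unique (*-≉0 x≉0 y≉0) (begin
    x * y * (x ⁻¹ * y ⁻¹)      ≈⟨ solve 4 (λ x y x' y' → x :* y :* (x' :* y') := (x :* x') :* (y :* y')) refl x y (x ⁻¹) (y ⁻¹) ⟩
    (x * x ⁻¹) * (y * y ⁻¹)    ≈⟨ *-cong (⁻¹-inverseʳ x≉0) (⁻¹-inverseʳ y≉0) ⟩
    1# * 1#                    ≈⟨ *-identityˡ 1# ⟩
    1#                         ∎)

  ÷-cong : ∀ {x y u v} → x ≈ u → y ≈ v → x ÷ y ≈ u ÷ v
  ÷-cong x≈u y≈v = *-cong x≈u (⁻¹-cong y≈v)

  ÷-*-÷ : ∀ {x y u v} → y ≉ 0# → v ≉ 0# → (x ÷ y) * (u ÷ v) ≈ (x * u) ÷ (y * v)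
  ÷-*-÷ {x} {y} {u} {v} y≉0 v≉0 = begin
    x * y ⁻¹ * (u * v ⁻¹)      ≈⟨ solve 4 (λ x y' u v' → x :* y' :* (u :* v') := (x :* u) :* (y' :* v')) refl x (y ⁻¹) u (v ⁻¹) ⟩
    (x * u) * (y ⁻¹ * v ⁻¹)    ≈⟨ *-congˡ (sym (⁻¹-distrib-* y≉0 v≉0)) ⟩
    (x * u) * (y * v) ⁻¹       ∎

  ÷-≈-÷ : ∀ {x y u v} → y ≉ 0# → v ≉ 0# → x * v ≈ u * y → x ÷ y ≈ u ÷ v
  ÷-≈-÷ {x} {y} {u} {v} y≉0 v≉0 e = *-cancelʳ (*-≉0 y≉0 v≉0) (begin
    x * y ⁻¹ * (y * v)         ≈⟨ solve 4 (λ x y' y v → x :* y' :* (y :* v) := (x :* v) :* (y :* y')) refl x (y ⁻¹) y v ⟩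
    (x * v) * (y * y ⁻¹)       ≈⟨ *-cong e (⁻¹-inverseʳ y≉0) ⟩
    (u * y) * 1#               ≈⟨ *-congˡ (sym (⁻¹-inverseʳ v≉0)) ⟩
    (u * y) * (v * v ⁻¹)       ≈⟨ solve 4 (λ u y v v' → (u :* y) :* (v :* v') := u :* v' :* (y :* v)) refl u y v (v ⁻¹) ⟩
    u * v ⁻¹ * (y * v)         ∎)

  ÷-*-cancel : ∀ {n d w g n' e} → d ≉ 0# → w * g ≈ d * e → n ≈ n' * g → (n ÷ d) * w ≈ n' * e
  ÷-*-cancel {n} {d} {w} {g} {n'} {e} d≉0 wg≈de n≈n'g = begin
    n * d ⁻¹ * w               ≈⟨ *-congʳ (*-congʳ n≈n'g) ⟩
    n' * g * d ⁻¹ * w          ≈⟨ solve 4 (λ n g d' w → n :* g :* d' :* w := n :* ((w :* g) :* d')) refl n' g (d ⁻¹) w ⟩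
    n' * ((w * g) * d ⁻¹)      ≈⟨ *-congˡ (*-congʳ wg≈de) ⟩
    n' * ((d * e) * d ⁻¹)      ≈⟨ solve 4 (λ n d e d' → n :* ((d :* e) :* d') := n :* e :* (d :* d')) refl n' d e (d ⁻¹) ⟩
    n' * e * (d * d ⁻¹)        ≈⟨ *-congˡ (⁻¹-inverseʳ d≉0) ⟩
    n' * e * 1#                ≈⟨ *-identityʳ _ ⟩
    n' * e                     ∎

  1-x≈0-reciprocal : ∀ {x y} → x * y ≈ 1# → 1# + - y ≈ 0# → 1# + - x ≈ 0#
  1-x≈0-reciprocal {x} {y} xy≈1 1-y≈0 = begin
    1# + - x              ≈⟨ +-congʳ (sym xy≈1) ⟩
    x * y + - x           ≈⟨ solve 2 (λ x y → x :* y :- x := x :* (:- (con (+ 1) :- y))) refl x y ⟩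
    x * - (1# + - y)      ≈⟨ *-annihilʳ (trans (-‿cong 1-y≈0) -0#≈0#) ⟩
    0#                    ∎

  [1-x]*y≈-[1-y] : ∀ {x y} → x * y ≈ 1# → (1# + - x) * y ≈ - (1# + - y)
  [1-x]*y≈-[1-y] {x} {y} xy≈1 = begin
    (1# + - x) * y    ≈⟨ solve 2 (λ x y → (con (+ 1) :- x) :* y := y :- x :* y) refl x y ⟩
    y + - (x * y)     ≈⟨ +-congˡ (-‿cong xy≈1) ⟩
    y + - 1#          ≈⟨ solve 1 (λ y → y :- con (+ 1) := :- (con (+ 1) :- y)) refl y ⟩
    - (1# + - y)      ∎

  pow-cong : ∀ {x y} n → x ≈ y → pow x n ≈ pow y n
  pow-cong zero    e = refl
  pow-cong (suc n) e = *-cong (pow-cong n e) e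

  pow-+ : ∀ x m n → pow x (m ℕ.+ n) ≈ pow x m * pow x n
  pow-+ x zero    n = sym (*-identityˡ _)
  pow-+ x (suc m) n = begin
    pow x (m ℕ.+ n) * x        ≈⟨ *-congʳ (pow-+ x m n) ⟩
    pow x m * pow x n * x      ≈⟨ solve 3 (λ a b x → a :* b :* x := a :* x :* b) refl (pow x m) (pow x n) x ⟩
    pow x m * x * pow x n      ∎

  pow-distrib-* : ∀ x y n → pow (x * y) n ≈ pow x n * pow y n
  pow-distrib-* x y zero    = sym (*-identityˡ 1#)
  pow-distrib-* x y (suc n) = begin
    pow (x * y) n * (x * y)        ≈⟨ *-congʳ (pow-distrib-* x y n) ⟩
    pow x n * pow y n * (x * y)    ≈⟨ solve 4 (λ a b x y → a :* b :* (x :* y) := a :* x :* (b :* y)) refl (pow x n) (pow y n) x y ⟩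
    pow x n * x * (pow y n * y)    ∎

  pow-square : ∀ x n → pow (x * x) n ≈ pow x (n ℕ.+ n)
  pow-square x n = trans (pow-distrib-* x x n) (sym (pow-+ x n n))

  pow-1# : ∀ n → pow 1# n ≈ 1#
  pow-1# zero    = refl
  pow-1# (suc n) = trans (*-identityʳ _) (pow-1# n)

  pow-inverse : ∀ {x y} n → x * y ≈ 1# → pow x n * pow y n ≈ 1#
  pow-inverse {x} {y} n e = trans (sym (pow-distrib-* x y n)) (trans (pow-cong n e) (pow-1# n))

  pow-≉0 : ∀ {x} n → x ≉ 0# → pow x n ≉ 0#
  pow-≉0 zero    x≉0 = 1≉0
  pow-≉0 (suc n) x≉0 = *-≉0 (pow-≉0 n x≉0) x≉0

  1-xp²p²ⁱ≉0 : ∀ {x} p → (∀ i → 1# + - (x * pow p (suc i)) ≉ 0#) → ∀ i → 1# + - (x * (p * p) * pow (p * p) i) ≉ 0#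
  1-xp²p²ⁱ≉0 {x} p 1-xpⁱ⁺¹≉0 i = ≉0-resp (+-congˡ (-‿cong xp²ⁱ⁺²≈xp²·p²ⁱ)) (1-xpⁱ⁺¹≉0 (suc (i ℕ.+ i)))
    where
    xp²ⁱ⁺²≈xp²·p²ⁱ : x * (pow p (i ℕ.+ i) * p * p) ≈ x * (p * p) * pow (p * p) i
    xp²ⁱ⁺²≈xp²·p²ⁱ = trans (solve 3 (λ x p r → x :* (r :* p :* p) := x :* (p :* p) :* r) refl x p (pow p (i ℕ.+ i)))
                           (*-congˡ (sym (pow-square p i)))

  poch-cong : ∀ {x y p p'} n → x ≈ y → p ≈ p' → poch x p n ≈ poch y p' n
  poch-cong zero    x≈y p≈p' = refl
  poch-cong (suc n) x≈y p≈p' = *-cong (poch-cong n x≈y p≈p') (+-congˡ (-‿cong (*-cong x≈y (pow-cong n p≈p'))))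

  poch-+ : ∀ x p m n → poch x p (m ℕ.+ n) ≈ poch x p m * poch (x * pow p m) p n
  poch-+ x p m zero = begin
    poch x p (m ℕ.+ 0)   ≡⟨ ≡.cong (poch x p) (ℕP.+-identityʳ m) ⟩
    poch x p m           ≈⟨ sym (*-identityʳ _) ⟩
    poch x p m * 1#      ∎
  poch-+ x p m (suc n) = begin
    poch x p (m ℕ.+ suc n)
      ≡⟨ ≡.cong (poch x p) (ℕP.+-suc m n) ⟩
    poch x p (m ℕ.+ n) * (1# + - (x * pow p (m ℕ.+ n)))
      ≈⟨ *-cong (poch-+ x p m n) (+-congˡ (-‿cong (*-congˡ (pow-+ p m n)))) ⟩
    poch x p m * poch (x * pow p m) p n * (1# + - (x * (pow p m * pow p n)))
      ≈⟨ trans (*-assoc _ _ _) (*-congˡ (*-congˡ (+-congˡ (-‿cong (sym (*-assoc _ _ _)))))) ⟩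
    poch x p m * (poch (x * pow p m) p n * (1# + - (x * pow p m * pow p n))) ∎

  poch-suc-front : ∀ x p n → poch x p (suc n) ≈ (1# + - x) * poch (x * p) p n
  poch-suc-front x p n = begin
    poch x p (1 ℕ.+ n)                   ≈⟨ poch-+ x p 1 n ⟩
    poch x p 1 * poch (x * pow p 1) p n  ≈⟨ *-cong (trans (*-identityˡ _) (+-congˡ (-‿cong (*-identityʳ x))))
                                                   (poch-cong n (*-congˡ (*-identityˡ p)) refl) ⟩
    (1# + - x) * poch (x * p) p n        ∎

  poch-even-odd : ∀ x p n → poch x p (n ℕ.+ n) ≈ poch x (p * p) n * poch (x * p) (p * p) n
  poch-even-odd x p zero    = sym (*-identityˡ 1#)
  poch-even-odd x p (suc n) = begin
    poch x p (suc n ℕ.+ suc n)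
      ≡⟨ ≡.cong (λ t → poch x p (suc t)) (ℕP.+-suc n n) ⟩
    poch x p (n ℕ.+ n) * (1# + - (x * p²ⁿ)) * (1# + - (x * (p²ⁿ * p)))
      ≈⟨ *-congʳ (*-congʳ (poch-even-odd x p n)) ⟩
    poch x (p * p) n * poch (x * p) (p * p) n * (1# + - (x * p²ⁿ)) * (1# + - (x * (p²ⁿ * p)))
      ≈⟨ solve 6 (λ a b x r p o → a :* b :* (o :- x :* r) :* (o :- x :* (r :* p)) := a :* (o :- x :* r) :* (b :* (o :- x :* p :* r)))
               refl (poch x (p * p) n) (poch (x * p) (p * p) n) x p²ⁿ p 1# ⟩
    poch x (p * p) n * (1# + - (x * p²ⁿ)) * (poch (x * p) (p * p) n * (1# + - (x * p * p²ⁿ)))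
      ≈⟨ *-cong (*-congˡ (+-congˡ (-‿cong (*-congˡ (sym (pow-square p n))))))
                (*-congˡ (+-congˡ (-‿cong (*-congˡ (sym (pow-square p n)))))) ⟩
    poch x (p * p) (suc n) * poch (x * p) (p * p) (suc n) ∎
    where p²ⁿ = pow p (n ℕ.+ n)

  poch-≉0 : ∀ x p n → (∀ i → i < n → 1# + - (x * pow p i) ≉ 0#) → poch x p n ≉ 0#
  poch-≉0 x p zero    factors≉0 = 1≉0
  poch-≉0 x p (suc n) factors≉0 =
    *-≉0 (poch-≉0 x p n (λ i i<n → factors≉0 i (ℕP.m≤n⇒m≤1+n i<n))) (factors≉0 n ℕP.≤-refl)

  poch-≈0 : ∀ x p n i → i < n → x * pow p i ≈ 1# → poch x p n ≈ 0#
  poch-≈0 x p (suc n) i i<1+n xpⁱ≈1 with i ℕ.≟ n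
  ... | yes ≡.refl = begin
    poch x p n * (1# + - (x * pow p n))   ≈⟨ *-congˡ (+-congˡ (-‿cong xpⁱ≈1)) ⟩
    poch x p n * (1# + - 1#)              ≈⟨ *-annihilʳ (-‿inverseʳ 1#) ⟩
    0#                                    ∎
  ... | no i≢n = *-annihilˡ (poch-≈0 x p n i (ℕP.≤∧≢⇒< (ℕP.≤-pred i<1+n) i≢n) xpⁱ≈1)

  sumTo-cong : ∀ n {f g : ℕ → Carrier} → (∀ i → i ≤ n → f i ≈ g i) → sumTo n f ≈ sumTo n g
  sumTo-cong zero    f≈g = f≈g 0 z≤n
  sumTo-cong (suc n) f≈g = +-cong (sumTo-cong n (λ i i≤n → f≈g i (ℕP.m≤n⇒m≤1+n i≤n))) (f≈g (suc n) ℕP.≤-refl)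

  sumTo-*ˡ : ∀ n x (f : ℕ → Carrier) → x * sumTo n f ≈ sumTo n (λ i → x * f i)
  sumTo-*ˡ zero    x f = refl
  sumTo-*ˡ (suc n) x f = trans (distribˡ _ _ _) (+-congʳ (sumTo-*ˡ n x f))

  sumTo-+ : ∀ n (f g : ℕ → Carrier) → sumTo n (λ i → f i + g i) ≈ sumTo n f + sumTo n g
  sumTo-+ zero    f g = refl
  sumTo-+ (suc n) f g = begin
    sumTo n (λ i → f i + g i) + (f (suc n) + g (suc n))  ≈⟨ +-congʳ (sumTo-+ n f g) ⟩
    sumTo n f + sumTo n g + (f (suc n) + g (suc n))      ≈⟨ +-interchange _ _ _ _ ⟩
    sumTo n f + f (suc n) + (sumTo n g + g (suc n))      ∎

  sumTo-suc-front : ∀ n (f : ℕ → Carrier) → sumTo (suc n) f ≈ f 0 + sumTo n (λ i → f (suc i))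
  sumTo-suc-front zero    f = refl
  sumTo-suc-front (suc n) f = trans (+-congʳ (sumTo-suc-front n f)) (+-assoc _ _ _)

  sumTo-telescope : ∀ n (h : ℕ → Carrier) → sumTo n (λ k → h (suc k) + - h k) ≈ h (suc n) + - h 0
  sumTo-telescope zero    h = refl
  sumTo-telescope (suc n) h = begin
    sumTo n (λ k → h (suc k) + - h k) + (h (suc (suc n)) + - h (suc n))
      ≈⟨ +-congʳ (sumTo-telescope n h) ⟩
    h (suc n) + - h 0 + (h (suc (suc n)) + - h (suc n))
      ≈⟨ solve 3 (λ a b c → a :- b :+ (c :- a) := c :- b) refl (h (suc n)) (h 0) (h (suc (suc n))) ⟩
    h (suc (suc n)) + - h 0 ∎

  sumTo-vanishing-tail : ∀ {m} n (f : ℕ → Carrier) → (∀ i → m < i → f i ≈ 0#) → m ≤ n → sumTo n f ≈ sumTo m f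
  sumTo-vanishing-tail zero    f tail≈0 z≤n = refl
  sumTo-vanishing-tail {m} (suc n) f tail≈0 m≤1+n with m ℕP.≟ suc n
  ... | yes ≡.refl = refl
  ... | no m≢1+n = begin
    sumTo n f + f (suc n)  ≈⟨ +-cong (sumTo-vanishing-tail n f tail≈0 m≤n) (tail≈0 (suc n) (s≤s m≤n)) ⟩
    sumTo m f + 0#         ≈⟨ +-identityʳ _ ⟩
    sumTo m f              ∎
    where m≤n = ℕP.≤-pred (ℕP.≤∧≢⇒< m≤1+n m≢1+n)

  sumTo-triangle-swap : ∀ n (g : ℕ → ℕ → Carrier) →
    sumTo n (λ r → sumTo r (g r)) ≈ sumTo n (λ s → sumTo (n ∸ s) (λ k → g (s ℕ.+ k) s))
  sumTo-triangle-swap zero    g = refl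
  sumTo-triangle-swap (suc n) g = begin
    sumTo n (λ r → sumTo r (g r)) + sumTo (suc n) (g (suc n))
      ≈⟨ +-congʳ (sumTo-triangle-swap n g) ⟩
    sumTo n (λ s → sumTo (n ∸ s) (column s)) + (sumTo n (g (suc n)) + g (suc n) (suc n))
      ≈⟨ sym (+-assoc _ _ _) ⟩
    sumTo n (λ s → sumTo (n ∸ s) (column s)) + sumTo n (g (suc n)) + g (suc n) (suc n)
      ≈⟨ +-cong (sym (sumTo-+ n _ _)) (reflexive (≡.cong (λ t → g t (suc n)) (≡.sym (ℕP.+-identityʳ (suc n))))) ⟩
    sumTo n (λ s → sumTo (n ∸ s) (column s) + g (suc n) s) + column (suc n) 0
      ≈⟨ +-congʳ (sumTo-cong n extend-column) ⟩
    sumTo n (λ s → sumTo (suc n ∸ s) (column s)) + column (suc n) 0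
      ≡⟨ ≡.cong (λ t → sumTo n (λ s → sumTo (suc n ∸ s) (column s)) + sumTo t (column (suc n))) (≡.sym (ℕP.n∸n≡0 n)) ⟩
    sumTo n (λ s → sumTo (suc n ∸ s) (column s)) + sumTo (n ∸ n) (column (suc n)) ∎
    where
    column : ℕ → ℕ → Carrier
    column s k = g (s ℕ.+ k) s
    extend-column : ∀ s → s ≤ n → sumTo (n ∸ s) (column s) + g (suc n) s ≈ sumTo (suc n ∸ s) (column s)
    extend-column s s≤n rewrite ℕP.+-∸-assoc 1 s≤n =
      +-congˡ (reflexive (≡.cong (λ t → g t s) (≡.sym (≡.trans (ℕP.+-suc s (n ∸ s)) (≡.cong suc (ℕP.m+[n∸m]≡n s≤n))))))

  sumTo-interleave : ∀ n (f g : ℕ → Carrier) →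
    sumTo n (λ i → interleave f i * g i) ≈ sumTo ⌊ n /2⌋ (λ s → f s * g (s ℕ.+ s))
  sumTo-interleave zero          f g = refl
  sumTo-interleave (suc zero)    f g = trans (+-congˡ (zeroˡ _)) (+-identityʳ _)
  sumTo-interleave (suc (suc n)) f g = begin
    sumTo (suc (suc n)) (λ i → interleave f i * g i)
      ≈⟨ sumTo-suc-front (suc n) _ ⟩
    f 0 * g 0 + sumTo (suc n) (λ i → interleave f (suc i) * g (suc i))
      ≈⟨ +-congˡ (sumTo-suc-front n _) ⟩
    f 0 * g 0 + (0# * g 1 + sumTo n (λ i → interleave (λ k → f (suc k)) i * g (suc (suc i))))
      ≈⟨ +-congˡ (trans (+-congʳ (zeroˡ _)) (+-identityˡ _)) ⟩
    f 0 * g 0 + sumTo n (λ i → interleave (λ k → f (suc k)) i * g (suc (suc i)))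
      ≈⟨ +-congˡ (sumTo-interleave n _ _) ⟩
    f 0 * g 0 + sumTo ⌊ n /2⌋ (λ s → f (suc s) * g (suc (suc (s ℕ.+ s))))
      ≈⟨ +-congˡ (sumTo-cong ⌊ n /2⌋ (λ s _ → *-congˡ (reflexive (≡.cong (λ t → g (suc t)) (≡.sym (ℕP.+-suc s s)))))) ⟩
    f 0 * g 0 + sumTo ⌊ n /2⌋ (λ s → f (suc s) * g (suc s ℕ.+ suc s))
      ≈⟨ sym (sumTo-suc-front ⌊ n /2⌋ _) ⟩
    sumTo (suc ⌊ n /2⌋) (λ s → f s * g (s ℕ.+ s)) ∎

⌊n/2⌋<i⇒n<i+i : ∀ n {i} → ⌊ n /2⌋ < i → n < i ℕ.+ i
⌊n/2⌋<i⇒n<i+i zero          {suc i} _ = s≤s z≤n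
⌊n/2⌋<i⇒n<i+i (suc zero)    {suc i} _ = s≤s (ℕP.≤-trans (s≤s z≤n) (ℕP.m≤n+m (suc i) i))
⌊n/2⌋<i⇒n<i+i (suc (suc n)) {suc i} (s≤s ⌊n/2⌋<i) =
  s≤s (≡.subst (suc n <_) (≡.sym (ℕP.+-suc i i)) (s≤s (⌊n/2⌋<i⇒n<i+i n ⌊n/2⌋<i)))

choose₂ : ℕ → ℕ
choose₂ zero    = 0
choose₂ (suc n) = choose₂ n ℕ.+ n

choose₂-+ : ∀ m n → choose₂ (m ℕ.+ n) ≡ choose₂ m ℕ.+ choose₂ n ℕ.+ m ℕ.* n
choose₂-+ m zero = begin
  choose₂ (m ℕ.+ 0)                  ≡⟨ ≡.cong choose₂ (ℕP.+-identityʳ m) ⟩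
  choose₂ m                          ≡⟨ pad m (choose₂ m) ⟩
  choose₂ m ℕ.+ 0 ℕ.+ m ℕ.* 0        ∎
  where
  open ≡.≡-Reasoning
  pad : ∀ m c → c ≡ c ℕ.+ 0 ℕ.+ m ℕ.* 0
  pad = ℕ-solve-∀
choose₂-+ m (suc n) = begin
  choose₂ (m ℕ.+ suc n)                                   ≡⟨ ≡.cong choose₂ (ℕP.+-suc m n) ⟩
  choose₂ (m ℕ.+ n) ℕ.+ (m ℕ.+ n)                         ≡⟨ ≡.cong (ℕ._+ (m ℕ.+ n)) (choose₂-+ m n) ⟩
  choose₂ m ℕ.+ choose₂ n ℕ.+ m ℕ.* n ℕ.+ (m ℕ.+ n)       ≡⟨ regroup m n (choose₂ m) (choose₂ n) ⟩
  choose₂ m ℕ.+ (choose₂ n ℕ.+ n) ℕ.+ m ℕ.* suc n         ∎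
  where
  open ≡.≡-Reasoning
  regroup : ∀ m n c d → c ℕ.+ d ℕ.+ m ℕ.* n ℕ.+ (m ℕ.+ n) ≡ c ℕ.+ (d ℕ.+ n) ℕ.+ m ℕ.* suc n
  regroup = ℕ-solve-∀

choose₂-double : ∀ n → choose₂ n ℕ.+ choose₂ n ℕ.+ n ≡ n ℕ.* n
choose₂-double zero    = ≡.refl
choose₂-double (suc n) = begin
  choose₂ n ℕ.+ n ℕ.+ (choose₂ n ℕ.+ n) ℕ.+ suc n     ≡⟨ regroup n (choose₂ n) ⟩
  (choose₂ n ℕ.+ choose₂ n ℕ.+ n) ℕ.+ (suc n ℕ.+ n)  ≡⟨ ≡.cong (ℕ._+ (suc n ℕ.+ n)) (choose₂-double n) ⟩
  n ℕ.* n ℕ.+ (suc n ℕ.+ n)                          ≡⟨ square-suc n ⟩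
  suc n ℕ.* suc n                                    ∎
  where
  open ≡.≡-Reasoning
  regroup : ∀ n c → c ℕ.+ n ℕ.+ (c ℕ.+ n) ℕ.+ suc n ≡ (c ℕ.+ c ℕ.+ n) ℕ.+ (suc n ℕ.+ n)
  regroup = ℕ-solve-∀
  square-suc : ∀ n → n ℕ.* n ℕ.+ (suc n ℕ.+ n) ≡ suc n ℕ.* suc n
  square-suc = ℕ-solve-∀

reversalExponent : ℕ → ℕ → ℕ
reversalExponent N s = (N ℕ.* s ℕ.+ choose₂ s) ℕ.+ (N ℕ.* s ℕ.+ choose₂ s)

reversalExponent-suc : ∀ N s → reversalExponent N (suc s) ≡ reversalExponent N s ℕ.+ ((N ℕ.+ s) ℕ.+ (N ℕ.+ s))
reversalExponent-suc N s = regroup N s (choose₂ s)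
  where
  regroup : ∀ N s c → (N ℕ.* suc s ℕ.+ (c ℕ.+ s)) ℕ.+ (N ℕ.* suc s ℕ.+ (c ℕ.+ s))
                      ≡ ((N ℕ.* s ℕ.+ c) ℕ.+ (N ℕ.* s ℕ.+ c)) ℕ.+ ((N ℕ.+ s) ℕ.+ (N ℕ.+ s))
  regroup = ℕ-solve-∀

reversalExponent-even : ∀ s m →
  (s ℕ.+ s) ℕ.+ reversalExponent (s ℕ.+ m) s ℕ.+ choose₂ (s ℕ.+ s) ≡ s ℕ.* s ℕ.+ (s ℕ.+ s) ℕ.* ((s ℕ.+ s) ℕ.+ m)
reversalExponent-even s m = begin
  (s ℕ.+ s) ℕ.+ reversalExponent (s ℕ.+ m) s ℕ.+ choose₂ (s ℕ.+ s)
    ≡⟨ ≡.cong ((s ℕ.+ s) ℕ.+ reversalExponent (s ℕ.+ m) s ℕ.+_) (choose₂-+ s s) ⟩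
  (s ℕ.+ s) ℕ.+ reversalExponent (s ℕ.+ m) s ℕ.+ (choose₂ s ℕ.+ choose₂ s ℕ.+ s ℕ.* s)
    ≡⟨ regroup s m (choose₂ s) ⟩
  (choose₂ s ℕ.+ choose₂ s ℕ.+ s) ℕ.+ (choose₂ s ℕ.+ choose₂ s ℕ.+ s) ℕ.+ (3 ℕ.* s ℕ.* s ℕ.+ 2 ℕ.* m ℕ.* s)
    ≡⟨ ≡.cong (λ t → t ℕ.+ t ℕ.+ (3 ℕ.* s ℕ.* s ℕ.+ 2 ℕ.* m ℕ.* s)) (choose₂-double s) ⟩
  s ℕ.* s ℕ.+ s ℕ.* s ℕ.+ (3 ℕ.* s ℕ.* s ℕ.+ 2 ℕ.* m ℕ.* s)
    ≡⟨ collect s m ⟩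
  s ℕ.* s ℕ.+ (s ℕ.+ s) ℕ.* ((s ℕ.+ s) ℕ.+ m) ∎
  where
  open ≡.≡-Reasoning
  regroup : ∀ s m c → (s ℕ.+ s) ℕ.+ (((s ℕ.+ m) ℕ.* s ℕ.+ c) ℕ.+ ((s ℕ.+ m) ℕ.* s ℕ.+ c)) ℕ.+ (c ℕ.+ c ℕ.+ s ℕ.* s)
                    ≡ (c ℕ.+ c ℕ.+ s) ℕ.+ (c ℕ.+ c ℕ.+ s) ℕ.+ (3 ℕ.* s ℕ.* s ℕ.+ 2 ℕ.* m ℕ.* s)
  regroup = ℕ-solve-∀
  collect : ∀ s m → s ℕ.* s ℕ.+ s ℕ.* s ℕ.+ (3 ℕ.* s ℕ.* s ℕ.+ 2 ℕ.* m ℕ.* s) ≡ s ℕ.* s ℕ.+ (s ℕ.+ s) ℕ.* ((s ℕ.+ s) ℕ.+ m)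
  collect = ℕ-solve-∀


module _ {c ℓ} (F : Field c ℓ) where

  open FieldArithmetic F

  -- summand (q⁻ᵐ) k is the k-th term of the sum in the header, with C standing for B⁻¹.
  module Summation (q Q A B C : Carrier) (qQ≈1 : q * Q ≈ 1#) (BC≈1 : B * C ≈ 1#)
    (1-qⁱ⁺¹≉0 : ∀ i → 1# + - pow q (suc i) ≉ 0#)
    (1-Aqⁱ⁺¹≉0 : ∀ i → 1# + - (A * pow q (suc i)) ≉ 0#)
    (1-Bqⁱ≉0 : ∀ i → 1# + - (B * pow q i) ≉ 0#) where

    P : Carrier
    P = q * q

    numerator : Carrier → ℕ → Carrier
    numerator x k = poch (A * q * C) P k * poch x q (k ℕ.+ k) * pow P k

    denominator : Carrier → ℕ → Carrier
    denominator x k = poch P P k * poch (A * P) P k * poch (P * (x * x) * C) P k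

    summand : Carrier → ℕ → Carrier
    summand x k = numerator x k ÷ denominator x k

    closedForm : ℕ → Carrier
    closedForm m = (poch B q m * poch (A * q) P m) ÷ (poch B P m * poch (A * q) q m)

    Qq≈1 : Q * q ≈ 1#
    Qq≈1 = trans (*-comm Q q) qQ≈1

    q≉0 : q ≉ 0#
    q≉0 q≈0 = 1≉0 (trans (sym qQ≈1) (*-annihilˡ q≈0))

    qⁿQⁿ≈1 : ∀ n → pow q n * pow Q n ≈ 1#
    qⁿQⁿ≈1 n = pow-inverse n qQ≈1

    Qⁿqⁿ≈1 : ∀ n → pow Q n * pow q n ≈ 1#
    Qⁿqⁿ≈1 n = pow-inverse n Qq≈1

    Pᵏ≉0 : ∀ k → pow P k ≉ 0#
    Pᵏ≉0 k = pow-≉0 k (*-≉0 q≉0 q≉0)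

    1-QᵉC≉0 : ∀ e → 1# + - (pow Q e * C) ≉ 0#
    1-QᵉC≉0 e 1-QᵉC≈0 = 1-Bqⁱ≉0 e (1-x≈0-reciprocal Bqᵉ·QᵉC≈1 1-QᵉC≈0)
      where
      Bqᵉ·QᵉC≈1 : B * pow q e * (pow Q e * C) ≈ 1#
      Bqᵉ·QᵉC≈1 = begin
        B * pow q e * (pow Q e * C)    ≈⟨ solve 4 (λ b x y c → b :* x :* (y :* c) := (x :* y) :* (b :* c)) refl B (pow q e) (pow Q e) C ⟩
        (pow q e * pow Q e) * (B * C)  ≈⟨ *-cong (qⁿQⁿ≈1 e) BC≈1 ⟩
        1# * 1#                        ≈⟨ *-identityˡ 1# ⟩
        1#                             ∎

    1-Qⁿ⁺¹≉0 : ∀ n → 1# + - pow Q (suc n) ≉ 0#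
    1-Qⁿ⁺¹≉0 n 1-Qⁿ⁺¹≈0 = 1-qⁱ⁺¹≉0 n (1-x≈0-reciprocal (qⁿQⁿ≈1 (suc n)) 1-Qⁿ⁺¹≈0)

    Qʲ⁺ᵈqʲ≈Qᵈ : ∀ j d → pow Q (j ℕ.+ d) * pow q j ≈ pow Q d
    Qʲ⁺ᵈqʲ≈Qᵈ j d = begin
      pow Q (j ℕ.+ d) * pow q j ≈⟨ *-congʳ (pow-+ Q j d) ⟩
      pow Q j * pow Q d * pow q j ≈⟨ solve 3 (λ a b c → a :* b :* c := (a :* c) :* b) refl (pow Q j) (pow Q d) (pow q j) ⟩
      (pow Q j * pow q j) * pow Q d ≈⟨ *-congʳ (Qⁿqⁿ≈1 j) ⟩
      1# * pow Q d ≈⟨ *-identityˡ _ ⟩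
      pow Q d ∎

    1-P·Pⁱ≉0 : ∀ i → 1# + - (P * pow P i) ≉ 0#
    1-P·Pⁱ≉0 i = ≉0-resp (+-congˡ (-‿cong (trans (solve 2 (λ q r → r :* q :* q := q :* q :* r) refl q (pow q (i ℕ.+ i))) (*-congˡ (sym (pow-square q i)))))) (1-qⁱ⁺¹≉0 (suc (i ℕ.+ i)))

    1-AP·Pⁱ≉0 : ∀ i → 1# + - (A * P * pow P i) ≉ 0#
    1-AP·Pⁱ≉0 = 1-xp²p²ⁱ≉0 q 1-Aqⁱ⁺¹≉0

    closedForm-denominator≉0 : ∀ m → poch B P m * poch (A * q) q m ≉ 0#
    closedForm-denominator≉0 m = *-≉0 (poch-≉0 B P m (λ i _ → ≉0-resp (+-congˡ (-‿cong (*-congˡ (sym (pow-square q i))))) (1-Bqⁱ≉0 (i ℕ.+ i))))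
                   (poch-≉0 (A * q) q m (λ i _ → ≉0-resp (+-congˡ (-‿cong (solve 3 (λ a q r → a :* (r :* q) := a :* q :* r) refl A q (pow q i)))) (1-Aqⁱ⁺¹≉0 i)))

    module Step (m : ℕ) where
      x u qᵐ uq y : Carrier
      x = pow Q m
      u = x * Q
      qᵐ = pow q m
      uq = u * q
      y = uq * uq * C

      uq≈x : uq ≈ x
      uq≈x = begin
        x * Q * q ≈⟨ *-assoc _ _ _ ⟩
        x * (Q * q) ≈⟨ *-congˡ Qq≈1 ⟩
        x * 1# ≈⟨ *-identityʳ x ⟩
        x ∎

      qᵐuq≈1 : qᵐ * uq ≈ 1#
      qᵐuq≈1 = trans (*-congˡ uq≈x) (qⁿQⁿ≈1 m)

      1-yPʲ≉0 : ∀ j → j ≤ m → 1# + - (y * pow P j) ≉ 0#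
      1-yPʲ≉0 j j≤m = ≉0-resp (+-congˡ (-‿cong (sym yPʲ≈Q²ᵈC))) (1-QᵉC≉0 (d ℕ.+ d))
        where
        d = m ∸ j
        uq≈Qʲ⁺ᵈ : uq ≈ pow Q (j ℕ.+ d)
        uq≈Qʲ⁺ᵈ = trans uq≈x (reflexive (≡.cong (pow Q) (≡.sym (ℕP.m+[n∸m]≡n j≤m))))
        yPʲ≈Q²ᵈC : y * pow P j ≈ pow Q (d ℕ.+ d) * C
        yPʲ≈Q²ᵈC = begin
          uq * uq * C * pow P j ≈⟨ *-cong (*-congʳ (*-cong uq≈Qʲ⁺ᵈ uq≈Qʲ⁺ᵈ)) (pow-distrib-* q q j) ⟩
          pow Q (j ℕ.+ d) * pow Q (j ℕ.+ d) * C * (pow q j * pow q j) ≈⟨ solve 4 (λ a c b e → a :* a :* c :* (b :* e) := (a :* b) :* (a :* e) :* c) refl (pow Q (j ℕ.+ d)) C (pow q j) (pow q j) ⟩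
          (pow Q (j ℕ.+ d) * pow q j) * (pow Q (j ℕ.+ d) * pow q j) * C ≈⟨ *-congʳ (*-cong (Qʲ⁺ᵈqʲ≈Qᵈ j d) (Qʲ⁺ᵈqʲ≈Qᵈ j d)) ⟩
          pow Q d * pow Q d * C ≈⟨ *-congʳ (sym (pow-+ Q d d)) ⟩
          pow Q (d ℕ.+ d) * C ∎

      1-u≉0 : 1# + - u ≉ 0#
      1-u≉0 = 1-Qⁿ⁺¹≉0 m

      dρ : Carrier
      dρ = (uq * uq * C + - 1#) * (uq + - (A * q))

      dρ≉0 : dρ ≉ 0#
      dρ≉0 = *-≉0 y-1≉0 uq-Aq≉0
        where
        y-1≉0 : uq * uq * C + - 1# ≉ 0#
        y-1≉0 e = 1-yPʲ≉0 0 z≤n (begin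
          1# + - (uq * uq * C * 1#) ≈⟨ solve 1 (λ y → con (+ 1) :- y :* con (+ 1) := :- (y :- con (+ 1))) refl y ⟩
          - (uq * uq * C + - 1#) ≈⟨ trans (-‿cong e) -0#≈0# ⟩
          0# ∎)
        uq-Aq≉0 : uq + - (A * q) ≉ 0#
        uq-Aq≉0 e = 1-Aqⁱ⁺¹≉0 m (begin
          1# + - (A * (qᵐ * q)) ≈⟨ +-congʳ (sym qᵐuq≈1) ⟩
          qᵐ * uq + - (A * (qᵐ * q)) ≈⟨ solve 4 (λ qᵐ x a q → qᵐ :* x :- a :* (qᵐ :* q) := qᵐ :* (x :- a :* q)) refl qᵐ uq A q ⟩
          qᵐ * (uq + - (A * q)) ≈⟨ *-annihilʳ e ⟩
          0# ∎)

      ρ ρ̃ κ : Carrier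
      ρ = ((1# + - (B * qᵐ)) * (1# + - (A * q * pow P m))) ÷ ((1# + - (B * pow P m)) * (1# + - (A * q * qᵐ)))
      ρ̃ = ((uq * C + - 1#) * (uq * uq + - (A * q))) ÷ dρ
      κ = (- uq) ÷ dρ

      ρ-denominator≉0 : (1# + - (B * pow P m)) * (1# + - (A * q * qᵐ)) ≉ 0#
      ρ-denominator≉0 = *-≉0 (≉0-resp (+-congˡ (-‿cong (*-congˡ (sym (pow-square q m))))) (1-Bqⁱ≉0 (m ℕ.+ m)))
                  (≉0-resp (+-congˡ (-‿cong (solve 3 (λ a qᵐ q → a :* (qᵐ :* q) := a :* q :* qᵐ) refl A qᵐ q))) (1-Aqⁱ⁺¹≉0 m))

      closedForm-suc : closedForm (suc m) ≈ ρ * closedForm m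
      closedForm-suc = sym (begin
        ρ * closedForm m ≈⟨ ÷-*-÷ ρ-denominator≉0 (closedForm-denominator≉0 m) ⟩
        (((1# + - (B * qᵐ)) * (1# + - (A * q * pow P m))) * (poch B q m * poch (A * q) P m)) ÷ (((1# + - (B * pow P m)) * (1# + - (A * q * qᵐ))) * (poch B P m * poch (A * q) q m))
          ≈⟨ ÷-cong (solve 4 (λ a b c d → (a :* b) :* (c :* d) := c :* a :* (d :* b)) refl _ _ _ _) (solve 4 (λ a b c d → (a :* b) :* (c :* d) := c :* a :* (d :* b)) refl _ _ _ _) ⟩
        closedForm (suc m) ∎)

      Pᵐ≈qᵐqᵐ : pow P m ≈ qᵐ * qᵐ
      Pᵐ≈qᵐqᵐ = pow-distrib-* q q m

      ρ≈ρ̃ : ρ ≈ ρ̃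
      ρ≈ρ̃ = begin
        ρ ≈⟨ ÷-cong (*-cong 1-Bqᵐ≈Bqᵐ[uqC-1] 1-AqPᵐ≈qᵐqᵐ[uquq-Aq]) (*-cong 1-BPᵐ≈BPᵐ[y-1] 1-Aqqᵐ≈qᵐ[uq-Aq]) ⟩
        (B * qᵐ * (uq * C + - 1#) * (qᵐ * qᵐ * (uq * uq + - (A * q)))) ÷ (B * (qᵐ * qᵐ) * (uq * uq * C + - 1#) * (qᵐ * (uq + - (A * q))))
          ≈⟨ ÷-≈-÷ (≉0-resp (*-cong 1-BPᵐ≈BPᵐ[y-1] 1-Aqqᵐ≈qᵐ[uq-Aq]) ρ-denominator≉0) dρ≉0 (solve 7 (λ b qᵐ x c a q o → b :* qᵐ :* (x :* c :- o) :* (qᵐ :* qᵐ :* (x :* x :- a :* q)) :* ((x :* x :* c :- o) :* (x :- a :* q)) := (x :* c :- o) :* (x :* x :- a :* q) :* (b :* (qᵐ :* qᵐ) :* (x :* x :* c :- o) :* (qᵐ :* (x :- a :* q)))) refl B qᵐ uq C A q 1#) ⟩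
        ρ̃ ∎
        where
          1-Bqᵐ≈Bqᵐ[uqC-1] : 1# + - (B * qᵐ) ≈ B * qᵐ * (uq * C + - 1#)
          1-Bqᵐ≈Bqᵐ[uqC-1] = sym (begin
            B * qᵐ * (uq * C + - 1#) ≈⟨ solve 4 (λ b qᵐ x c → b :* qᵐ :* (x :* c :- con (+ 1)) := (qᵐ :* x) :* (b :* c) :- b :* qᵐ) refl B qᵐ uq C ⟩
            (qᵐ * uq) * (B * C) + - (B * qᵐ) ≈⟨ +-congʳ (trans (*-cong qᵐuq≈1 BC≈1) (*-identityˡ 1#)) ⟩
            1# + - (B * qᵐ) ∎)

          1-AqPᵐ≈qᵐqᵐ[uquq-Aq] : 1# + - (A * q * pow P m) ≈ qᵐ * qᵐ * (uq * uq + - (A * q))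
          1-AqPᵐ≈qᵐqᵐ[uquq-Aq] = sym (begin
            qᵐ * qᵐ * (uq * uq + - (A * q)) ≈⟨ solve 4 (λ qᵐ x a q → qᵐ :* qᵐ :* (x :* x :- a :* q) := (qᵐ :* x) :* (qᵐ :* x) :- a :* q :* (qᵐ :* qᵐ)) refl qᵐ uq A q ⟩
            (qᵐ * uq) * (qᵐ * uq) + - (A * q * (qᵐ * qᵐ)) ≈⟨ +-cong (trans (*-cong qᵐuq≈1 qᵐuq≈1) (*-identityˡ 1#)) (-‿cong (*-congˡ (sym Pᵐ≈qᵐqᵐ))) ⟩
            1# + - (A * q * pow P m) ∎)

          1-BPᵐ≈BPᵐ[y-1] : 1# + - (B * pow P m) ≈ B * (qᵐ * qᵐ) * (uq * uq * C + - 1#)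
          1-BPᵐ≈BPᵐ[y-1] = sym (begin
            B * (qᵐ * qᵐ) * (uq * uq * C + - 1#) ≈⟨ solve 4 (λ b qᵐ x c → b :* (qᵐ :* qᵐ) :* (x :* x :* c :- con (+ 1)) := (qᵐ :* x) :* (qᵐ :* x) :* (b :* c) :- b :* (qᵐ :* qᵐ)) refl B qᵐ uq C ⟩
            (qᵐ * uq) * (qᵐ * uq) * (B * C) + - (B * (qᵐ * qᵐ)) ≈⟨ +-cong (trans (*-cong (trans (*-cong qᵐuq≈1 qᵐuq≈1) (*-identityˡ 1#)) BC≈1) (*-identityˡ 1#)) (-‿cong (*-congˡ (sym Pᵐ≈qᵐqᵐ))) ⟩
            1# + - (B * pow P m) ∎)

          1-Aqqᵐ≈qᵐ[uq-Aq] : 1# + - (A * q * qᵐ) ≈ qᵐ * (uq + - (A * q))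
          1-Aqqᵐ≈qᵐ[uq-Aq] = sym (begin
            qᵐ * (uq + - (A * q)) ≈⟨ solve 4 (λ qᵐ x a q → qᵐ :* (x :- a :* q) := qᵐ :* x :- a :* q :* qᵐ) refl qᵐ uq A q ⟩
            qᵐ * uq + - (A * q * qᵐ) ≈⟨ +-congʳ qᵐuq≈1 ⟩
            1# + - (A * q * qᵐ) ∎)

      certificate-num certificate-den certificateRatio certificate : ℕ → Carrier
      certificate-num k  = (1# + - pow P k) * (1# + - (A * pow P k)) * (1# + - y)
      certificate-den k  = (1# + - u) * pow P k
      certificateRatio k = certificate-num k ÷ certificate-den k
      certificate k      = κ * certificateRatio k * summand u k

      certificate-den≉0 : ∀ k → certificate-den k ≉ 0#
      certificate-den≉0 k = *-≉0 1-u≉0 (Pᵏ≉0 k)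

      P·uu·C≈y : P * (u * u) * C ≈ y
      P·uu·C≈y = solve 3 (λ q u c → q :* q :* (u :* u) :* c := u :* q :* (u :* q) :* c) refl q u C

      denominator-u≉0 : ∀ j → j ≤ m → denominator u j ≉ 0#
      denominator-u≉0 j j≤m = *-≉0 (*-≉0 (poch-≉0 P P j (λ i _ → 1-P·Pⁱ≉0 i)) (poch-≉0 (A * P) P j (λ i _ → 1-AP·Pⁱ≉0 i)))
                          (poch-≉0 (P * (u * u) * C) P j (λ i i<j → ≉0-resp (+-congˡ (-‿cong (*-congʳ (sym P·uu·C≈y)))) (1-yPʲ≉0 i (ℕP.≤-trans (ℕP.<⇒≤ i<j) j≤m))))

      module AtIndex (k : ℕ) (k≤m : k ≤ m) where
        z w : Carrier
        z = pow P k
        w = u * z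

        1-yPᵏ≉0 : 1# + - (y * z) ≉ 0#
        1-yPᵏ≉0 = 1-yPʲ≉0 k k≤m

        denominator-x≉0 : denominator x k ≉ 0#
        denominator-x≉0 = *-≉0 (*-≉0 (poch-≉0 P P k (λ i _ → 1-P·Pⁱ≉0 i)) (poch-≉0 (A * P) P k (λ i _ → 1-AP·Pⁱ≉0 i)))
                      (poch-≉0 (P * (x * x) * C) P k (λ i i<k → ≉0-resp (+-congˡ (-‿cong (yPⁱ⁺¹≈P·xx·C·Pⁱ i))) (1-yPʲ≉0 (suc i) (ℕP.≤-trans i<k k≤m))))
          where
          yPⁱ⁺¹≈P·xx·C·Pⁱ : ∀ i → y * pow P (suc i) ≈ P * (x * x) * C * pow P i
          yPⁱ⁺¹≈P·xx·C·Pⁱ i = trans (solve 4 (λ x c q r → x :* x :* c :* (r :* (q :* q)) := q :* q :* (x :* x) :* c :* r) refl uq C q (pow P i))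
                      (*-congʳ (*-congʳ (*-congˡ (*-cong uq≈x uq≈x))))

        q²ᵏ≈z : pow q (k ℕ.+ k) ≈ z
        q²ᵏ≈z = sym (pow-square q k)

        shiftRatio-num shiftRatio-den shiftRatio : Carrier
        shiftRatio-num = (1# + - w) * (1# + - y)
        shiftRatio-den = (1# + - u) * (1# + - (y * z))
        shiftRatio = shiftRatio-num ÷ shiftRatio-den

        shiftRatio-den≉0 : shiftRatio-den ≉ 0#
        shiftRatio-den≉0 = *-≉0 1-u≉0 1-yPᵏ≉0

        poch-x-shift : poch x q (k ℕ.+ k) * (1# + - u) ≈ poch u q (k ℕ.+ k) * (1# + - w)
        poch-x-shift = begin
          poch x q (k ℕ.+ k) * (1# + - u) ≈⟨ *-comm _ _ ⟩
          (1# + - u) * poch x q (k ℕ.+ k) ≈⟨ *-congˡ (poch-cong (k ℕ.+ k) (sym uq≈x) refl) ⟩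
          (1# + - u) * poch (u * q) q (k ℕ.+ k) ≈⟨ sym (poch-suc-front u q (k ℕ.+ k)) ⟩
          poch u q (k ℕ.+ k) * (1# + - (u * pow q (k ℕ.+ k))) ≈⟨ *-congˡ (+-congˡ (-‿cong (*-congˡ q²ᵏ≈z))) ⟩
          poch u q (k ℕ.+ k) * (1# + - w) ∎

        poch-xx-shift : poch (P * (x * x) * C) P k * (1# + - y) ≈ poch (P * (u * u) * C) P k * (1# + - (y * z))
        poch-xx-shift = begin
          poch (P * (x * x) * C) P k * (1# + - y) ≈⟨ *-comm _ _ ⟩
          (1# + - y) * poch (P * (x * x) * C) P k ≈⟨ *-congˡ (poch-cong k (trans (*-congʳ (*-congˡ (*-cong (sym uq≈x) (sym uq≈x)))) (solve 3 (λ q x c → q :* q :* (x :* x) :* c := x :* x :* c :* (q :* q)) refl q uq C)) refl) ⟩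
          (1# + - y) * poch (y * P) P k ≈⟨ sym (poch-suc-front y P k) ⟩
          poch y P k * (1# + - (y * z)) ≈⟨ *-congʳ (poch-cong k (sym P·uu·C≈y) refl) ⟩
          poch (P * (u * u) * C) P k * (1# + - (y * z)) ∎

        summand-shift : summand x k ≈ summand u k * shiftRatio
        summand-shift = begin
          numerator x k ÷ denominator x k ≈⟨ ÷-≈-÷ denominator-x≉0 (*-≉0 (denominator-u≉0 k k≤m) shiftRatio-den≉0) cross-multiplied-eq ⟩
          (numerator u k * shiftRatio-num) ÷ (denominator u k * shiftRatio-den) ≈⟨ sym (÷-*-÷ (denominator-u≉0 k k≤m) shiftRatio-den≉0) ⟩
          summand u k * shiftRatio ∎
          where
          a = poch (A * q * C) P k
          p = pow P k
          d1 = poch P P k * poch (A * P) P k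
          cross-multiplied-eq : numerator x k * (denominator u k * shiftRatio-den) ≈ (numerator u k * shiftRatio-num) * denominator x k
          cross-multiplied-eq = begin
            a * poch x q (k ℕ.+ k) * p * (d1 * poch (P * (u * u) * C) P k * ((1# + - u) * (1# + - (y * z))))
              ≈⟨ solve 8 (λ a px p d1 pu o y w → a :* px :* p :* (d1 :* pu :* (o :* y)) := a :* (px :* o) :* p :* d1 :* (pu :* y)) refl a (poch x q (k ℕ.+ k)) p d1 (poch (P * (u * u) * C) P k) (1# + - u) (1# + - (y * z)) 1# ⟩
            a * (poch x q (k ℕ.+ k) * (1# + - u)) * p * d1 * (poch (P * (u * u) * C) P k * (1# + - (y * z)))
              ≈⟨ *-cong (*-congʳ (*-congʳ (*-congˡ poch-x-shift))) (sym poch-xx-shift) ⟩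
            a * (poch u q (k ℕ.+ k) * (1# + - w)) * p * d1 * (poch (P * (x * x) * C) P k * (1# + - y))
              ≈⟨ solve 8 (λ a pu p d1 px o y w → a :* (pu :* w) :* p :* d1 :* (px :* y) := a :* pu :* p :* (w :* y) :* (d1 :* px)) refl a (poch u q (k ℕ.+ k)) p d1 (poch (P * (x * x) * C) P k) 1# (1# + - y) (1# + - w) ⟩
            a * poch u q (k ℕ.+ k) * p * shiftRatio-num * (d1 * poch (P * (x * x) * C) P k) ∎

        sucRatio-num sucRatio-den sucRatio : Carrier
        sucRatio-num = (1# + - (A * q * C * z)) * (1# + - w) * (1# + - (w * q)) * P
        sucRatio-den = (1# + - (P * z)) * (1# + - (A * P * z)) * (1# + - (y * z))
        sucRatio = sucRatio-num ÷ sucRatio-den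

        sucRatio-den≉0 : sucRatio-den ≉ 0#
        sucRatio-den≉0 = *-≉0 (*-≉0 (1-P·Pⁱ≉0 k) (1-AP·Pⁱ≉0 k)) 1-yPᵏ≉0

        poch-u-suc : poch u q (suc k ℕ.+ suc k) ≈ poch u q (k ℕ.+ k) * (1# + - w) * (1# + - (w * q))
        poch-u-suc = begin
          poch u q (suc k ℕ.+ suc k) ≡⟨ ≡.cong (λ n → poch u q (suc n)) (ℕP.+-suc k k) ⟩
          poch u q (k ℕ.+ k) * (1# + - (u * pow q (k ℕ.+ k))) * (1# + - (u * (pow q (k ℕ.+ k) * q)))
            ≈⟨ *-cong (*-congˡ (+-congˡ (-‿cong (*-congˡ q²ᵏ≈z)))) (+-congˡ (-‿cong (trans (sym (*-assoc _ _ _)) (*-congʳ (*-congˡ q²ᵏ≈z))))) ⟩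
          poch u q (k ℕ.+ k) * (1# + - w) * (1# + - (w * q)) ∎

        summand-suc : summand u (suc k) ≈ summand u k * sucRatio
        summand-suc = begin
          numerator u (suc k) ÷ denominator u (suc k) ≈⟨ ÷-cong numerator-eq denominator-eq ⟩
          (numerator u k * sucRatio-num) ÷ (denominator u k * sucRatio-den) ≈⟨ sym (÷-*-÷ (denominator-u≉0 k k≤m) sucRatio-den≉0) ⟩
          summand u k * sucRatio ∎
          where
          a = poch (A * q * C) P k
          numerator-eq : numerator u (suc k) ≈ numerator u k * sucRatio-num
          numerator-eq = begin
            a * (1# + - (A * q * C * z)) * poch u q (suc k ℕ.+ suc k) * (z * P) ≈⟨ *-congʳ (*-congˡ poch-u-suc) ⟩
            a * (1# + - (A * q * C * z)) * (poch u q (k ℕ.+ k) * (1# + - w) * (1# + - (w * q))) * (z * P)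
              ≈⟨ solve 8 (λ a f pu g1 g2 z p o → a :* f :* (pu :* g1 :* g2) :* (z :* p) := a :* pu :* z :* (f :* g1 :* g2 :* p)) refl a (1# + - (A * q * C * z)) (poch u q (k ℕ.+ k)) (1# + - w) (1# + - (w * q)) z P 1# ⟩
            numerator u k * sucRatio-num ∎
          denominator-eq : denominator u (suc k) ≈ denominator u k * sucRatio-den
          denominator-eq = begin
            poch P P k * (1# + - (P * z)) * (poch (A * P) P k * (1# + - (A * P * z))) * (poch (P * (u * u) * C) P k * (1# + - (P * (u * u) * C * z)))
              ≈⟨ *-congˡ (*-congˡ (+-congˡ (-‿cong (*-congʳ P·uu·C≈y)))) ⟩
            poch P P k * (1# + - (P * z)) * (poch (A * P) P k * (1# + - (A * P * z))) * (poch (P * (u * u) * C) P k * (1# + - (y * z)))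
              ≈⟨ solve 6 (λ a b c d e f → a :* b :* (c :* d) :* (e :* f) := a :* c :* e :* (b :* d :* f)) refl (poch P P k) (1# + - (P * z)) (poch (A * P) P k) (1# + - (A * P * z)) (poch (P * (u * u) * C) P k) (1# + - (y * z)) ⟩
            denominator u k * sucRatio-den ∎

        -- the telescoping identity divided by summand u k; it is identically 1 as a rational function
        ρ̃-num common-den ratio-sum : Carrier
        ρ̃-num = (uq * C + - 1#) * (uq * uq + - (A * q))
        common-den = dρ * shiftRatio-den * z
        ratio-sum = ρ̃ * shiftRatio + (κ * (certificateRatio (suc k) * sucRatio) + - (κ * certificateRatio k))

        common-den≉0 : common-den ≉ 0#
        common-den≉0 = *-≉0 (*-≉0 dρ≉0 shiftRatio-den≉0) (Pᵏ≉0 k)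

        next-term-num current-term-num : Carrier
        next-term-num = (- uq) * (1# + - y) * (1# + - (A * q * C * z)) * (1# + - w) * (1# + - (w * q))
        current-term-num = (- uq) * certificate-num k

        cleared-ρ-term : (ρ̃ * shiftRatio) * common-den ≈ (ρ̃-num * shiftRatio-num) * z
        cleared-ρ-term = begin
          (ρ̃ * shiftRatio) * common-den ≈⟨ *-congʳ (÷-*-÷ dρ≉0 shiftRatio-den≉0) ⟩
          ((ρ̃-num * shiftRatio-num) ÷ (dρ * shiftRatio-den)) * common-den ≈⟨ ÷-*-cancel (*-≉0 dρ≉0 shiftRatio-den≉0) (solve 3 (λ a b z → a :* b :* z :* con (+ 1) := (a :* b) :* z) refl dρ shiftRatio-den z) (sym (*-identityʳ _)) ⟩
          (ρ̃-num * shiftRatio-num) * z ∎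

        cleared-next-term : (κ * (certificateRatio (suc k) * sucRatio)) * common-den ≈ next-term-num * 1#
        cleared-next-term = begin
          (κ * (certificateRatio (suc k) * sucRatio)) * common-den ≈⟨ *-congʳ (trans (*-congˡ (÷-*-÷ (certificate-den≉0 (suc k)) sucRatio-den≉0)) (÷-*-÷ dρ≉0 (*-≉0 (certificate-den≉0 (suc k)) sucRatio-den≉0))) ⟩
          (((- uq) * (certificate-num (suc k) * sucRatio-num)) ÷ (dρ * (certificate-den (suc k) * sucRatio-den))) * common-den
            ≈⟨ ÷-*-cancel {g = P * ((1# + - (P * z)) * (1# + - (A * P * z)))} (*-≉0 dρ≉0 (*-≉0 (certificate-den≉0 (suc k)) sucRatio-den≉0))
                 (solve 6 (λ d u q z a c → d :* ((con (+ 1) :- u) :* (con (+ 1) :- u :* q :* (u :* q) :* c :* z)) :* z :* (q :* q :* ((con (+ 1) :- q :* q :* z) :* (con (+ 1) :- a :* (q :* q) :* z)))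
                    := d :* ((con (+ 1) :- u) :* (z :* (q :* q)) :* ((con (+ 1) :- q :* q :* z) :* (con (+ 1) :- a :* (q :* q) :* z) :* (con (+ 1) :- u :* q :* (u :* q) :* c :* z))) :* con (+ 1)) refl dρ u q z A C)
                 (solve 5 (λ u q z a c → (:- (u :* q)) :* ((con (+ 1) :- z :* (q :* q)) :* (con (+ 1) :- a :* (z :* (q :* q))) :* (con (+ 1) :- u :* q :* (u :* q) :* c)
                        :* ((con (+ 1) :- a :* q :* c :* z) :* (con (+ 1) :- u :* z) :* (con (+ 1) :- u :* z :* q) :* (q :* q)))
                    := (:- (u :* q)) :* (con (+ 1) :- u :* q :* (u :* q) :* c) :* (con (+ 1) :- a :* q :* c :* z) :* (con (+ 1) :- u :* z) :* (con (+ 1) :- u :* z :* q)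
                        :* (q :* q :* ((con (+ 1) :- q :* q :* z) :* (con (+ 1) :- a :* (q :* q) :* z)))) refl u q z A C) ⟩
          next-term-num * 1# ∎

        cleared-current-term : (κ * certificateRatio k) * common-den ≈ current-term-num * (1# + - (y * z))
        cleared-current-term = begin
          (κ * certificateRatio k) * common-den ≈⟨ *-congʳ (÷-*-÷ dρ≉0 (certificate-den≉0 k)) ⟩
          (((- uq) * certificate-num k) ÷ (dρ * certificate-den k)) * common-den ≈⟨ ÷-*-cancel (*-≉0 dρ≉0 (certificate-den≉0 k)) (solve 4 (λ d u y z → d :* ((con (+ 1) :- u) :* (con (+ 1) :- y)) :* z :* con (+ 1) := d :* ((con (+ 1) :- u) :* z) :* (con (+ 1) :- y)) refl dρ u (y * z) z) (sym (*-identityʳ _)) ⟩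
          current-term-num * (1# + - (y * z)) ∎

        cleared-identity : (ρ̃-num * shiftRatio-num) * z + (next-term-num * 1# + - (current-term-num * (1# + - (y * z)))) ≈ 1# * common-den
        cleared-identity = solve 5 (λ u q z A C →
          let x = u :* q ; w = u :* z ; y = x :* x :* C ; one = con (+ 1) in
          ((x :* C :- one) :* (x :* x :- A :* q)) :* ((one :- w) :* (one :- y)) :* z
            :+ ((:- x) :* (one :- y) :* (one :- A :* q :* C :* z) :* (one :- w) :* (one :- w :* q) :* one
               :- (:- x) :* ((one :- z) :* (one :- A :* z) :* (one :- y)) :* (one :- y :* z))
          := one :* ((x :* x :* C :- one) :* (x :- A :* q) :* ((one :- u) :* (one :- y :* z)) :* z)) refl u q z A C

        ratio-sum≈1 : ratio-sum ≈ 1#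
        ratio-sum≈1 = *-cancelʳ common-den≉0 (begin
          ratio-sum * common-den ≈⟨ solve 7 (λ a b c d e f w → (a :* b :+ (c :* (d :* e) :- c :* f)) :* w := a :* b :* w :+ (c :* (d :* e) :* w :- c :* f :* w)) refl ρ̃ shiftRatio κ (certificateRatio (suc k)) sucRatio (certificateRatio k) common-den ⟩
          (ρ̃ * shiftRatio) * common-den + ((κ * (certificateRatio (suc k) * sucRatio)) * common-den + - ((κ * certificateRatio k) * common-den)) ≈⟨ +-cong cleared-ρ-term (+-cong cleared-next-term (-‿cong cleared-current-term)) ⟩
          (ρ̃-num * shiftRatio-num) * z + (next-term-num * 1# + - (current-term-num * (1# + - (y * z)))) ≈⟨ cleared-identity ⟩
          1# * common-den ∎)

        telescoping-step : summand u k ≈ ρ * summand x k + (certificate (suc k) + - certificate k)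
        telescoping-step = sym (begin
          ρ * summand x k + (κ * certificateRatio (suc k) * summand u (suc k) + - (κ * certificateRatio k * summand u k)) ≈⟨ +-cong (*-cong ρ≈ρ̃ summand-shift) (+-congʳ (*-congˡ summand-suc)) ⟩
          ρ̃ * (summand u k * shiftRatio) + (κ * certificateRatio (suc k) * (summand u k * sucRatio) + - (κ * certificateRatio k * summand u k))
            ≈⟨ solve 7 (λ r t x1 k f1 x2 f0 → r :* (t :* x1) :+ (k :* f1 :* (t :* x2) :- k :* f0 :* t) := t :* (r :* x1 :+ (k :* (f1 :* x2) :- k :* f0))) refl ρ̃ (summand u k) shiftRatio κ (certificateRatio (suc k)) sucRatio (certificateRatio k) ⟩
          summand u k * ratio-sum ≈⟨ *-congˡ ratio-sum≈1 ⟩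
          summand u k * 1# ≈⟨ *-identityʳ _ ⟩
          summand u k ∎)

      certificate-0 : certificate 0 ≈ 0#
      certificate-0 = *-annihilˡ (*-annihilʳ (*-annihilˡ (*-annihilˡ (*-annihilˡ (-‿inverseʳ 1#)))))

      summand-vanishes : ∀ {v} n k → ⌊ n /2⌋ < k → v * pow q n ≈ 1# → summand v k ≈ 0#
      summand-vanishes {v} n k ⌊n/2⌋<k vqⁿ≈1 =
        *-annihilˡ (*-annihilˡ (*-annihilʳ (poch-≈0 v q (k ℕ.+ k) n (⌊n/2⌋<i⇒n<i+i n ⌊n/2⌋<k) vqⁿ≈1)))

      T : ℕ
      T = ⌊ suc m /2⌋

      certificate-end : certificate (suc T) ≈ 0#
      certificate-end = *-annihilʳ (summand-vanishes (suc m) (suc T) (ℕP.n<1+n T) (Qⁿqⁿ≈1 (suc m)))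

      summation-step : sumTo ⌊ m /2⌋ (summand x) ≈ closedForm m → sumTo T (summand u) ≈ closedForm (suc m)
      summation-step ih = begin
        sumTo T (summand u)
          ≈⟨ sumTo-cong T (λ k k≤T → AtIndex.telescoping-step k (ℕP.≤-trans k≤T (ℕP.⌈n/2⌉≤n m))) ⟩
        sumTo T (λ k → ρ * summand x k + (certificate (suc k) + - certificate k))
          ≈⟨ sumTo-+ T _ _ ⟩
        sumTo T (λ k → ρ * summand x k) + sumTo T (λ k → certificate (suc k) + - certificate k)
          ≈⟨ +-cong (sym (sumTo-*ˡ T ρ (summand x))) (sumTo-telescope T certificate) ⟩
        ρ * sumTo T (summand x) + (certificate (suc T) + - certificate 0)
          ≈⟨ +-cong (*-congˡ (sumTo-vanishing-tail T (summand x) (λ k lt → summand-vanishes m k lt (Qⁿqⁿ≈1 m))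
                                                   (ℕP.⌊n/2⌋-mono (ℕP.n≤1+n m))))
                    (+-cong certificate-end (-‿cong certificate-0)) ⟩
        ρ * sumTo ⌊ m /2⌋ (summand x) + (0# + - 0#)
          ≈⟨ trans (+-congˡ (trans (+-identityˡ _) -0#≈0#)) (+-identityʳ _) ⟩
        ρ * sumTo ⌊ m /2⌋ (summand x)
          ≈⟨ *-congˡ ih ⟩
        ρ * closedForm m
          ≈⟨ sym closedForm-suc ⟩
        closedForm (suc m) ∎

    summation : ∀ m → sumTo ⌊ m /2⌋ (summand (pow Q m)) ≈ closedForm m
    summation zero    = ÷-cong (*-identityʳ _) (*-identityʳ _)
    summation (suc m) = Step.summation-step m (summation m)

  module Reversal (q Q : Carrier) (qQ≈1 : q * Q ≈ 1#) where

    P : Carrier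
    P = q * q

    Qq≈1 : Q * q ≈ 1#
    Qq≈1 = trans (*-comm Q q) qQ≈1

    poch-q⁻ᴸ-reversal : ∀ n m →
      poch (pow Q (n ℕ.+ m)) q n * poch q q m * pow q (n ℕ.* (n ℕ.+ m)) ≈ pow (- 1#) n * pow q (choose₂ n) * poch q q (n ℕ.+ m)
    poch-q⁻ᴸ-reversal zero    m = solve 1 (λ a → con (+ 1) :* a :* con (+ 1) := con (+ 1) :* con (+ 1) :* a) refl (poch q q m)
    poch-q⁻ᴸ-reversal (suc n) m = begin
      poch Q⁻ᴸ q (suc n) * poch q q m * pow q (suc n ℕ.* suc (n ℕ.+ m))
        ≈⟨ *-cong (*-congʳ (poch-suc-front _ q n)) (reflexive (≡.cong (pow q) (exponent n m))) ⟩
      (1# + - Q⁻ᴸ) * poch (Q⁻ᴸ * q) q n * poch q q m * pow q (n ℕ.* (n ℕ.+ m) ℕ.+ (n ℕ.+ suc (n ℕ.+ m)))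
        ≈⟨ *-cong (*-congʳ (*-congˡ (poch-cong n Q⁻ᴸq≈Q¹⁻ᴸ refl)))
                  (trans (pow-+ q (n ℕ.* (n ℕ.+ m)) (n ℕ.+ suc (n ℕ.+ m))) (*-congˡ (pow-+ q n (suc (n ℕ.+ m))))) ⟩
      (1# + - Q⁻ᴸ) * poch (pow Q (n ℕ.+ m)) q n * poch q q m * (pow q (n ℕ.* (n ℕ.+ m)) * (pow q n * qᴸ))
        ≈⟨ solve 7 (λ a v w z b c d → a :* v :* w :* (z :* (b :* c)) := (a :* c) :* b :* (v :* w :* z)) refl
                 (1# + - Q⁻ᴸ) (poch (pow Q (n ℕ.+ m)) q n) (poch q q m) (pow q (n ℕ.* (n ℕ.+ m))) (pow q n) qᴸ 1# ⟩
      ((1# + - Q⁻ᴸ) * qᴸ) * pow q n * (poch (pow Q (n ℕ.+ m)) q n * poch q q m * pow q (n ℕ.* (n ℕ.+ m)))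
        ≈⟨ *-cong (*-congʳ ([1-x]*y≈-[1-y] (pow-inverse (suc (n ℕ.+ m)) Qq≈1))) (poch-q⁻ᴸ-reversal n m) ⟩
      (- (1# + - qᴸ)) * pow q n * (pow (- 1#) n * pow q (choose₂ n) * poch q q (n ℕ.+ m))
        ≈⟨ solve 5 (λ l b s t w → (:- (con (+ 1) :- l)) :* b :* (s :* t :* w) := s :* (:- con (+ 1)) :* (t :* b) :* (w :* (con (+ 1) :- l)))
                 refl qᴸ (pow q n) (pow (- 1#) n) (pow q (choose₂ n)) (poch q q (n ℕ.+ m)) ⟩
      pow (- 1#) n * (- 1#) * (pow q (choose₂ n) * pow q n) * (poch q q (n ℕ.+ m) * (1# + - qᴸ))
        ≈⟨ *-cong (*-congˡ (sym (pow-+ q (choose₂ n) n))) (*-congˡ (+-congˡ (-‿cong (*-comm _ _)))) ⟩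
      pow (- 1#) (suc n) * pow q (choose₂ (suc n)) * poch q q (suc (n ℕ.+ m)) ∎
      where
      Q⁻ᴸ qᴸ : Carrier
      Q⁻ᴸ = pow Q (suc (n ℕ.+ m))
      qᴸ  = pow q (suc (n ℕ.+ m))
      exponent : ∀ n m → suc n ℕ.* suc (n ℕ.+ m) ≡ n ℕ.* (n ℕ.+ m) ℕ.+ (n ℕ.+ suc (n ℕ.+ m))
      exponent = ℕ-solve-∀
      Q⁻ᴸq≈Q¹⁻ᴸ : Q⁻ᴸ * q ≈ pow Q (n ℕ.+ m)
      Q⁻ᴸq≈Q¹⁻ᴸ = trans (*-assoc _ _ _) (trans (*-congˡ Qq≈1) (*-identityʳ _))

    module _ (b b⁻ : Carrier) (bb⁻≈1 : b * b⁻ ≈ 1#) where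

      q²Q/b : ℕ → Carrier
      q²Q/b j = q * q * pow Q j * b⁻

      poch-reversal : ∀ s N →
        poch (q²Q/b ((N ℕ.+ s) ℕ.+ (N ℕ.+ s))) P s * pow b s * pow q (reversalExponent N s) ≈ pow (- 1#) s * poch (b * pow P N) P s
      poch-reversal zero N = begin
        1# * 1# * pow q (reversalExponent N 0)  ≡⟨ ≡.cong (λ t → 1# * 1# * pow q t) (vanishes N) ⟩
        1# * 1# * 1#                            ≈⟨ *-identityʳ _ ⟩
        1# * 1#                                 ∎
        where
        vanishes : ∀ N → (N ℕ.* 0 ℕ.+ 0) ℕ.+ (N ℕ.* 0 ℕ.+ 0) ≡ 0
        vanishes = ℕ-solve-∀
      poch-reversal (suc s) N = begin
        poch y' P (suc s) * pow b (suc s) * pow q (reversalExponent N (suc s))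
          ≈⟨ *-cong (*-congʳ (poch-suc-front y' P s))
                    (trans (reflexive (≡.cong (pow q) (reversalExponent-suc N s))) (pow-+ q (reversalExponent N s) j)) ⟩
        (1# + - y') * poch (y' * P) P s * (pow b s * b) * (pow q (reversalExponent N s) * pow q j)
          ≈⟨ solve 7 (λ a v bs b e w o → a :* v :* (bs :* b) :* (e :* w) := (a :* (b :* w)) :* (v :* bs :* e)) refl
                   (1# + - y') (poch (y' * P) P s) (pow b s) b (pow q (reversalExponent N s)) (pow q j) 1# ⟩
        ((1# + - y') * (b * pow q j)) * (poch (y' * P) P s * pow b s * pow q (reversalExponent N s))
          ≈⟨ *-cong ([1-x]*y≈-[1-y] y'bqʲ≈1) (*-congʳ (*-congʳ (poch-cong s y'P≈y refl))) ⟩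
        (- (1# + - (b * pow q j))) * (poch y P s * pow b s * pow q (reversalExponent N s))
          ≈⟨ *-congˡ (poch-reversal s N) ⟩
        (- (1# + - (b * pow q j))) * (pow (- 1#) s * poch (b * pow P N) P s)
          ≈⟨ solve 3 (λ x s v → (:- (con (+ 1) :- x)) :* (s :* v) := s :* (:- con (+ 1)) :* (v :* (con (+ 1) :- x))) refl
                   (b * pow q j) (pow (- 1#) s) (poch (b * pow P N) P s) ⟩
        pow (- 1#) s * (- 1#) * (poch (b * pow P N) P s * (1# + - (b * pow q j)))
          ≈⟨ *-congˡ (*-congˡ (+-congˡ (-‿cong bqʲ≈bPᴺPˢ))) ⟩
        pow (- 1#) (suc s) * poch (b * pow P N) P (suc s) ∎
        where
        j j' : ℕ
        j  = (N ℕ.+ s) ℕ.+ (N ℕ.+ s)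
        j' = (N ℕ.+ suc s) ℕ.+ (N ℕ.+ suc s)
        y y' : Carrier
        y  = q²Q/b j
        y' = q²Q/b j'
        j'≡2+j : ∀ N s → (N ℕ.+ suc s) ℕ.+ (N ℕ.+ suc s) ≡ 2 ℕ.+ ((N ℕ.+ s) ℕ.+ (N ℕ.+ s))
        j'≡2+j = ℕ-solve-∀
        Qʲ'≈QʲQQ : pow Q j' ≈ pow Q j * Q * Q
        Qʲ'≈QʲQQ = reflexive (≡.cong (pow Q) (j'≡2+j N s))
        y'P≈y : y' * P ≈ y
        y'P≈y = begin
          q * q * pow Q j' * b⁻ * (q * q)             ≈⟨ *-congʳ (*-congʳ (*-congˡ Qʲ'≈QʲQQ)) ⟩
          q * q * (pow Q j * Q * Q) * b⁻ * (q * q)    ≈⟨ solve 5 (λ q v Q b' o → q :* q :* (v :* Q :* Q) :* b' :* (q :* q) := q :* q :* v :* b' :* ((Q :* q) :* (Q :* q))) refl q (pow Q j) Q b⁻ 1# ⟩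
          y * ((Q * q) * (Q * q))                     ≈⟨ *-congˡ (trans (*-cong Qq≈1 Qq≈1) (*-identityˡ 1#)) ⟩
          y * 1#                                      ≈⟨ *-identityʳ _ ⟩
          y                                           ∎
        y'bqʲ≈1 : y' * (b * pow q j) ≈ 1#
        y'bqʲ≈1 = begin
          q * q * pow Q j' * b⁻ * (b * pow q j)
            ≈⟨ *-congʳ (*-congʳ (*-congˡ Qʲ'≈QʲQQ)) ⟩
          q * q * (pow Q j * Q * Q) * b⁻ * (b * pow q j)
            ≈⟨ solve 6 (λ q v Q b' b w → q :* q :* (v :* Q :* Q) :* b' :* (b :* w) := (q :* Q) :* (q :* Q) :* (v :* w) :* (b :* b')) refl q (pow Q j) Q b⁻ b (pow q j) ⟩
          (q * Q) * (q * Q) * (pow Q j * pow q j) * (b * b⁻)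
            ≈⟨ *-cong (*-cong (*-cong qQ≈1 qQ≈1) (trans (*-comm _ _) (pow-inverse j qQ≈1))) bb⁻≈1 ⟩
          1# * 1# * 1# * 1#
            ≈⟨ solve 0 (con (+ 1) :* con (+ 1) :* con (+ 1) :* con (+ 1) := con (+ 1)) refl ⟩
          1# ∎
        bqʲ≈bPᴺPˢ : b * pow q j ≈ b * pow P N * pow P s
        bqʲ≈bPᴺPˢ = trans (*-congˡ (trans (sym (pow-square q (N ℕ.+ s))) (pow-+ P N s))) (sym (*-assoc _ _ _))

  module Transformation (a b q : Carrier) (generic : Generic a b q) where

    q≉0 : q ≉ 0#
    q≉0 = proj₁ generic

    b≉0 : b ≉ 0#
    b≉0 = proj₁ (proj₂ generic)

    1-qⁱ⁺¹≉0 : ∀ i → 1# + - pow q (suc i) ≉ 0#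
    1-qⁱ⁺¹≉0 = proj₁ (proj₂ (proj₂ generic))

    1-aqⁱ⁺¹≉0 : ∀ i → 1# + - (a * pow q (suc i)) ≉ 0#
    1-aqⁱ⁺¹≉0 = proj₁ (proj₂ (proj₂ (proj₂ generic)))

    1-bqⁱ≉0 : ∀ i → 1# + - (b * pow q i) ≉ 0#
    1-bqⁱ≉0 = proj₂ (proj₂ (proj₂ (proj₂ generic)))

    Q b⁻¹ : Carrier
    Q   = q ⁻¹
    b⁻¹ = b ⁻¹

    qQ≈1 : q * Q ≈ 1#
    qQ≈1 = ⁻¹-inverseʳ q≉0

    bb⁻¹≈1 : b * b⁻¹ ≈ 1#
    bb⁻¹≈1 = ⁻¹-inverseʳ b≉0

    open Reversal q Q qQ≈1

    weight : Carrier → ℕ → ℕ → Carrier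
    weight p L r = poch p p (L ∸ r) * poch (a * p) p (L ℕ.+ r)

    prefactor : ℕ → Carrier
    prefactor L = poch b P L ÷ (poch q q L * poch b q L * poch (a * q) P L)

    coefficient : ℕ → ℕ → Carrier
    coefficient L r =
      (poch ((a * q) ÷ b) P r * poch (pow Q L) q (r ℕ.+ r) * pow q (r ℕ.+ r)) ÷ poch ((q * q * pow Q (L ℕ.+ L)) ÷ b) P r

    alphaFactor : ℕ → Carrier
    alphaFactor s = pow (- 1#) s * pow b s * pow q (s ℕ.* s) * poch ((a * q) ÷ b) P s ÷ poch (b * q) P s

    InnerSum : ℕ → ℕ → Set ℓ
    InnerSum L s =
      prefactor L * sumTo (⌊ L /2⌋ ∸ s) (λ k → coefficient L (s ℕ.+ k) * (weight P (s ℕ.+ k) s) ⁻¹)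
        ≈ alphaFactor s * (weight q L (s ℕ.+ s)) ⁻¹

    1-aP·Pⁱ≉0 : ∀ i → 1# + - (a * P * pow P i) ≉ 0#
    1-aP·Pⁱ≉0 = 1-xp²p²ⁱ≉0 q 1-aqⁱ⁺¹≉0

    1-Qᵈb⁻¹≉0 : ∀ d → 1# + - (pow Q d * b⁻¹) ≉ 0#
    1-Qᵈb⁻¹≉0 d 1-Qᵈb⁻¹≈0 = 1-bqⁱ≉0 d (1-x≈0-reciprocal bqᵈ·Qᵈb⁻¹≈1 1-Qᵈb⁻¹≈0)
      where
      bqᵈ·Qᵈb⁻¹≈1 : b * pow q d * (pow Q d * b⁻¹) ≈ 1#
      bqᵈ·Qᵈb⁻¹≈1 = begin
        b * pow q d * (pow Q d * b⁻¹)    ≈⟨ solve 4 (λ b x y b' → b :* x :* (y :* b') := (x :* y) :* (b :* b')) refl b (pow q d) (pow Q d) b⁻¹ ⟩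
        (pow q d * pow Q d) * (b * b⁻¹)  ≈⟨ *-cong (pow-inverse d qQ≈1) bb⁻¹≈1 ⟩
        1# * 1#                          ≈⟨ *-identityˡ 1# ⟩
        1#                               ∎

    1-yᴸPⁱ≉0 : ∀ L i → i < L → 1# + - ((q * q * pow Q (L ℕ.+ L)) ÷ b * pow P i) ≉ 0#
    1-yᴸPⁱ≉0 L i i<L = ≉0-resp (+-congˡ (-‿cong (sym yᴸPⁱ≈Q²ᵈb⁻¹))) (1-Qᵈb⁻¹≉0 (d ℕ.+ d))
      where
      d = L ∸ suc i
      L+L≡ : L ℕ.+ L ≡ (suc i ℕ.+ suc i) ℕ.+ (d ℕ.+ d)
      L+L≡ = ≡.trans (≡.cong (λ t → t ℕ.+ t) (≡.sym (ℕP.m+[n∸m]≡n i<L))) (regroup (suc i) d)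
        where
        regroup : ∀ x y → (x ℕ.+ y) ℕ.+ (x ℕ.+ y) ≡ (x ℕ.+ x) ℕ.+ (y ℕ.+ y)
        regroup = ℕ-solve-∀
      yᴸPⁱ≈Q²ᵈb⁻¹ : (q * q * pow Q (L ℕ.+ L)) ÷ b * pow P i ≈ pow Q (d ℕ.+ d) * b⁻¹
      yᴸPⁱ≈Q²ᵈb⁻¹ = begin
        q * q * pow Q (L ℕ.+ L) * b⁻¹ * pow P i
          ≈⟨ *-cong (*-congʳ (*-congˡ (trans (reflexive (≡.cong (pow Q) L+L≡)) (pow-+ Q (suc i ℕ.+ suc i) (d ℕ.+ d))))) (pow-square q i) ⟩
        q * q * (pow Q (suc i ℕ.+ suc i) * pow Q (d ℕ.+ d)) * b⁻¹ * pow q (i ℕ.+ i)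
          ≈⟨ solve 6 (λ q x y b' r o → q :* q :* (x :* y) :* b' :* r := (x :* (r :* q :* q)) :* (y :* b')) refl q (pow Q (suc i ℕ.+ suc i)) (pow Q (d ℕ.+ d)) b⁻¹ (pow q (i ℕ.+ i)) 1# ⟩
        (pow Q (suc i ℕ.+ suc i) * (pow q (i ℕ.+ i) * q * q)) * (pow Q (d ℕ.+ d) * b⁻¹)
          ≈⟨ *-congʳ (trans (*-congˡ (reflexive (≡.cong (pow q) (≡.sym (≡.cong suc (ℕP.+-suc i i)))))) (pow-inverse (suc i ℕ.+ suc i) Qq≈1)) ⟩
        1# * (pow Q (d ℕ.+ d) * b⁻¹)
          ≈⟨ *-identityˡ _ ⟩
        pow Q (d ℕ.+ d) * b⁻¹ ∎

    poch-q-q≉0 : ∀ n → poch q q n ≉ 0#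
    poch-q-q≉0 n = poch-≉0 q q n (λ i _ → ≉0-resp (+-congˡ (-‿cong (*-comm _ _))) (1-qⁱ⁺¹≉0 i))

    poch-b-q≉0 : ∀ n → poch b q n ≉ 0#
    poch-b-q≉0 n = poch-≉0 b q n (λ i _ → 1-bqⁱ≉0 i)

    poch-aq-P≉0 : ∀ n → poch (a * q) P n ≉ 0#
    poch-aq-P≉0 n = poch-≉0 (a * q) P n (λ i _ → ≉0-resp (+-congˡ (-‿cong (trans (*-congˡ (*-comm _ _)) (trans (sym (*-assoc _ _ _)) (*-congˡ (sym (pow-square q i))))))) (1-aqⁱ⁺¹≉0 (i ℕ.+ i)))

    poch-bq-P≉0 : ∀ n → poch (b * q) P n ≉ 0#
    poch-bq-P≉0 n = poch-≉0 (b * q) P n (λ i _ → ≉0-resp (+-congˡ (-‿cong (bq²ⁱq≈bqPⁱ i))) (1-bqⁱ≉0 (suc (i ℕ.+ i))))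
      where
      bq²ⁱq≈bqPⁱ : ∀ i → b * (pow q (i ℕ.+ i) * q) ≈ b * q * pow P i
      bq²ⁱq≈bqPⁱ i = trans (*-congˡ (*-comm _ _)) (trans (sym (*-assoc _ _ _)) (*-congˡ (sym (pow-square q i))))

    poch-aq-q≉0 : ∀ n → poch (a * q) q n ≉ 0#
    poch-aq-q≉0 n = poch-≉0 (a * q) q n (λ i _ → ≉0-resp (+-congˡ (-‿cong (trans (*-congˡ (*-comm _ _)) (sym (*-assoc _ _ _))))) (1-aqⁱ⁺¹≉0 i))

    ⌊2s+m/2⌋≡s+⌊m/2⌋ : ∀ s m → ⌊ s ℕ.+ s ℕ.+ m /2⌋ ≡ s ℕ.+ ⌊ m /2⌋
    ⌊2s+m/2⌋≡s+⌊m/2⌋ zero    m = ≡.refl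
    ⌊2s+m/2⌋≡s+⌊m/2⌋ (suc s) m = ≡.trans (≡.cong (λ t → ⌊ suc t ℕ.+ m /2⌋) (ℕP.+-suc s s)) (≡.cong suc (⌊2s+m/2⌋≡s+⌊m/2⌋ s m))

    -- For L = 2s + m the inner sum is Γ times the summation with a, b shifted to A = aq⁴ˢ, B = bq²ˢ.
    module InnerSumAt (s m : ℕ) where
      L : ℕ
      L = s ℕ.+ s ℕ.+ m
      x A B C yᴸ : Carrier
      x = pow Q m
      A = a * pow P (s ℕ.+ s)
      B = b * pow P s
      C = b⁻¹ * pow Q (s ℕ.+ s)
      yᴸ = (q * q * pow Q (L ℕ.+ L)) ÷ b

      PˢQ²ˢ≈1 : pow P s * pow Q (s ℕ.+ s) ≈ 1#
      PˢQ²ˢ≈1 = trans (*-congʳ (pow-square q s)) (pow-inverse (s ℕ.+ s) qQ≈1)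

      BC≈1 : B * C ≈ 1#
      BC≈1 = begin
        b * pow P s * (b⁻¹ * pow Q (s ℕ.+ s)) ≈⟨ solve 4 (λ b p b' r → b :* p :* (b' :* r) := (b :* b') :* (p :* r)) refl b (pow P s) b⁻¹ (pow Q (s ℕ.+ s)) ⟩
        (b * b⁻¹) * (pow P s * pow Q (s ℕ.+ s)) ≈⟨ *-cong bb⁻¹≈1 PˢQ²ˢ≈1 ⟩
        1# * 1# ≈⟨ *-identityˡ 1# ⟩
        1# ∎

      1-Aqⁱ⁺¹≉0 : ∀ i → 1# + - (A * pow q (suc i)) ≉ 0#
      1-Aqⁱ⁺¹≉0 i = ≉0-resp (+-congˡ (-‿cong (sym Aqⁱ⁺¹≈aqᵗ⁺ⁱ⁺¹))) (1-aqⁱ⁺¹≉0 (t ℕ.+ i))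
        where
        t = s ℕ.+ s ℕ.+ (s ℕ.+ s)
        Aqⁱ⁺¹≈aqᵗ⁺ⁱ⁺¹ : A * pow q (suc i) ≈ a * pow q (suc (t ℕ.+ i))
        Aqⁱ⁺¹≈aqᵗ⁺ⁱ⁺¹ = begin
          a * pow P (s ℕ.+ s) * pow q (suc i) ≈⟨ *-assoc _ _ _ ⟩
          a * (pow P (s ℕ.+ s) * pow q (suc i)) ≈⟨ *-congˡ (*-congʳ (pow-square q (s ℕ.+ s))) ⟩
          a * (pow q t * pow q (suc i)) ≈⟨ *-congˡ (sym (pow-+ q t (suc i))) ⟩
          a * pow q (t ℕ.+ suc i) ≡⟨ ≡.cong (λ n → a * pow q n) (ℕP.+-suc t i) ⟩
          a * pow q (suc (t ℕ.+ i)) ∎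

      1-Bqⁱ≉0 : ∀ i → 1# + - (B * pow q i) ≉ 0#
      1-Bqⁱ≉0 i = ≉0-resp (+-congˡ (-‿cong (sym Bqⁱ≈bq²ˢ⁺ⁱ))) (1-bqⁱ≉0 ((s ℕ.+ s) ℕ.+ i))
        where
        Bqⁱ≈bq²ˢ⁺ⁱ : B * pow q i ≈ b * pow q ((s ℕ.+ s) ℕ.+ i)
        Bqⁱ≈bq²ˢ⁺ⁱ = trans (*-assoc _ _ _) (*-congˡ (trans (*-congʳ (pow-square q s)) (sym (pow-+ q (s ℕ.+ s) i))))

      module S = Summation q Q A B C qQ≈1 BC≈1 1-qⁱ⁺¹≉0 1-Aqⁱ⁺¹≉0 1-Bqⁱ≉0

      Γ-num Γ-den Γ : Carrier
      Γ-num = poch ((a * q) ÷ b) P s * poch (pow Q L) q (s ℕ.+ s) * pow q (s ℕ.+ s)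
      Γ-den = poch yᴸ P s * poch (a * P) P (s ℕ.+ s)
      Γ = Γ-num ÷ Γ-den

      s+k≤L : ∀ {k} → k ≤ ⌊ m /2⌋ → s ℕ.+ k ≤ L
      s+k≤L {k} k≤⌊m/2⌋ = ℕP.≤-trans (ℕP.+-monoʳ-≤ s (ℕP.≤-trans k≤⌊m/2⌋ (ℕP.⌊n/2⌋≤n m))) (ℕP.≤-trans (ℕP.+-monoʳ-≤ s (ℕP.m≤n+m m s)) (ℕP.≤-reflexive (≡.sym (ℕP.+-assoc s s m))))

      Γ-den≉0 : Γ-den ≉ 0#
      Γ-den≉0 = *-≉0 (poch-≉0 yᴸ P s (λ i i<s → 1-yᴸPⁱ≉0 L i (ℕP.<-≤-trans i<s (ℕP.≤-trans (ℕP.m≤m+n s s) (ℕP.m≤m+n (s ℕ.+ s) m)))))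
                  (poch-≉0 (a * P) P (s ℕ.+ s) (λ i _ → 1-aP·Pⁱ≉0 i))

      aq/b·Pˢ≈AqC : (a * q) ÷ b * pow P s ≈ A * q * C
      aq/b·Pˢ≈AqC = sym (begin
        a * pow P (s ℕ.+ s) * q * (b⁻¹ * pow Q (s ℕ.+ s)) ≈⟨ *-congʳ (*-congʳ (*-congˡ (pow-+ P s s))) ⟩
        a * (pow P s * pow P s) * q * (b⁻¹ * pow Q (s ℕ.+ s)) ≈⟨ solve 5 (λ a p q b' r → a :* (p :* p) :* q :* (b' :* r) := a :* q :* b' :* p :* (p :* r)) refl a (pow P s) q b⁻¹ (pow Q (s ℕ.+ s)) ⟩
        a * q * b⁻¹ * pow P s * (pow P s * pow Q (s ℕ.+ s)) ≈⟨ *-congˡ PˢQ²ˢ≈1 ⟩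
        a * q * b⁻¹ * pow P s * 1# ≈⟨ *-identityʳ _ ⟩
        (a * q) ÷ b * pow P s ∎)

      yᴸPˢ≈P·xx·C : yᴸ * pow P s ≈ P * (x * x) * C
      yᴸPˢ≈P·xx·C = begin
        q * q * pow Q (L ℕ.+ L) * b⁻¹ * pow P s ≈⟨ *-congʳ (*-congʳ (*-congˡ (trans (reflexive (≡.cong (pow Q) (regroup s m))) (trans (pow-+ Q (s ℕ.+ s) _) (*-congˡ (trans (pow-+ Q (s ℕ.+ s) (m ℕ.+ m)) (*-congˡ (pow-+ Q m m)))))))) ⟩
        q * q * (pow Q (s ℕ.+ s) * (pow Q (s ℕ.+ s) * (x * x))) * b⁻¹ * pow P s
          ≈⟨ solve 6 (λ q r t b' p o → q :* q :* (r :* (r :* t)) :* b' :* p := q :* q :* t :* (b' :* r) :* (p :* r)) refl q (pow Q (s ℕ.+ s)) (x * x) b⁻¹ (pow P s) 1# ⟩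
        q * q * (x * x) * (b⁻¹ * pow Q (s ℕ.+ s)) * (pow P s * pow Q (s ℕ.+ s)) ≈⟨ *-congˡ PˢQ²ˢ≈1 ⟩
        q * q * (x * x) * C * 1# ≈⟨ *-identityʳ _ ⟩
        P * (x * x) * C ∎
        where
        regroup : ∀ s m → (s ℕ.+ s ℕ.+ m) ℕ.+ (s ℕ.+ s ℕ.+ m) ≡ (s ℕ.+ s) ℕ.+ ((s ℕ.+ s) ℕ.+ (m ℕ.+ m))
        regroup = ℕ-solve-∀

      coefficient≈Γ·summand : ∀ k → k ≤ ⌊ m /2⌋ → coefficient L (s ℕ.+ k) * (weight P (s ℕ.+ k) s) ⁻¹ ≈ Γ * S.summand x k
      coefficient≈Γ·summand k k≤⌊m/2⌋ = begin
        N * yᴸ-poch ⁻¹ * weight P (s ℕ.+ k) s ⁻¹ ≈⟨ trans (*-assoc _ _ _) (*-congˡ (sym (⁻¹-distrib-* yᴸ-poch≉0 weight-P≉0))) ⟩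
        N ÷ (yᴸ-poch * weight P (s ℕ.+ k) s) ≈⟨ ÷-cong numerator-eq denominator-eq ⟩
        (Γ-num * S.numerator x k) ÷ (Γ-den * S.denominator x k) ≈⟨ sym (÷-*-÷ Γ-den≉0 summand-den≉0) ⟩
        Γ * S.summand x k ∎
        where
        k≤m : k ≤ m
        k≤m = ℕP.≤-trans k≤⌊m/2⌋ (ℕP.⌊n/2⌋≤n m)
        N yᴸ-poch : Carrier
        N = poch ((a * q) ÷ b) P (s ℕ.+ k) * poch (pow Q L) q ((s ℕ.+ k) ℕ.+ (s ℕ.+ k)) * pow q ((s ℕ.+ k) ℕ.+ (s ℕ.+ k))
        yᴸ-poch = poch yᴸ P (s ℕ.+ k)
        yᴸ-poch≉0 : yᴸ-poch ≉ 0#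
        yᴸ-poch≉0 = poch-≉0 yᴸ P (s ℕ.+ k) (λ i i< → 1-yᴸPⁱ≉0 L i (ℕP.<-≤-trans i< (s+k≤L k≤⌊m/2⌋)))
        weight-P≉0 : weight P (s ℕ.+ k) s ≉ 0#
        weight-P≉0 = *-≉0 (poch-≉0 P P ((s ℕ.+ k) ∸ s) (λ i _ → S.1-P·Pⁱ≉0 i)) (poch-≉0 (a * P) P ((s ℕ.+ k) ℕ.+ s) (λ i _ → 1-aP·Pⁱ≉0 i))
        summand-den≉0 : S.denominator x k ≉ 0#
        summand-den≉0 = S.Step.AtIndex.denominator-x≉0 m k k≤m
        e2k : (s ℕ.+ k) ℕ.+ (s ℕ.+ k) ≡ (s ℕ.+ s) ℕ.+ (k ℕ.+ k)
        e2k = regroup s k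
          where
          regroup : ∀ s k → (s ℕ.+ k) ℕ.+ (s ℕ.+ k) ≡ (s ℕ.+ s) ℕ.+ (k ℕ.+ k)
          regroup = ℕ-solve-∀
        numerator-eq : N ≈ Γ-num * S.numerator x k
        numerator-eq = begin
          N ≈⟨ *-cong (*-cong (trans (poch-+ _ P s k) (*-congˡ (poch-cong k aq/b·Pˢ≈AqC refl)))
                              (trans (reflexive (≡.cong (poch (pow Q L) q) e2k)) (trans (poch-+ (pow Q L) q (s ℕ.+ s) (k ℕ.+ k)) (*-congˡ (poch-cong (k ℕ.+ k) (S.Qʲ⁺ᵈqʲ≈Qᵈ (s ℕ.+ s) m) refl)))))
                      (trans (reflexive (≡.cong (pow q) e2k)) (trans (pow-+ q (s ℕ.+ s) (k ℕ.+ k)) (*-congˡ (sym (pow-square q k))))) ⟩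
          poch ((a * q) ÷ b) P s * poch (A * q * C) P k * (poch (pow Q L) q (s ℕ.+ s) * poch x q (k ℕ.+ k)) * (pow q (s ℕ.+ s) * pow P k)
            ≈⟨ solve 6 (λ a1 a2 b1 b2 c1 c2 → a1 :* a2 :* (b1 :* b2) :* (c1 :* c2) := a1 :* b1 :* c1 :* (a2 :* b2 :* c2)) refl _ _ _ _ _ _ ⟩
          Γ-num * S.numerator x k ∎
        denominator-eq : yᴸ-poch * weight P (s ℕ.+ k) s ≈ Γ-den * S.denominator x k
        denominator-eq = begin
          yᴸ-poch * (poch P P ((s ℕ.+ k) ∸ s) * poch (a * P) P ((s ℕ.+ k) ℕ.+ s))
            ≡⟨ ≡.cong₂ (λ u v → yᴸ-poch * (poch P P u * poch (a * P) P v)) (ℕP.m+n∸m≡n s k) (regroup s k) ⟩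
          yᴸ-poch * (poch P P k * poch (a * P) P ((s ℕ.+ s) ℕ.+ k))
            ≈⟨ *-cong (trans (poch-+ yᴸ P s k) (*-congˡ (poch-cong k yᴸPˢ≈P·xx·C refl)))
                      (*-congˡ (trans (poch-+ (a * P) P (s ℕ.+ s) k) (*-congˡ (poch-cong k (solve 3 (λ a p t → a :* p :* t := a :* t :* p) refl a P (pow P (s ℕ.+ s))) refl)))) ⟩
          poch yᴸ P s * poch (P * (x * x) * C) P k * (poch P P k * (poch (a * P) P (s ℕ.+ s) * poch (A * P) P k))
            ≈⟨ solve 5 (λ y1 y2 p e1 e2 → y1 :* y2 :* (p :* (e1 :* e2)) := y1 :* e1 :* (p :* e2 :* y2)) refl _ _ _ _ _ ⟩
          Γ-den * S.denominator x k ∎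
          where
          regroup : ∀ s k → (s ℕ.+ k) ℕ.+ s ≡ (s ℕ.+ s) ℕ.+ k
          regroup = ℕ-solve-∀

      QL Qm V g2 Z1 Z2 T2 sg sg2 bs qss Y R : Carrier
      QL = poch q q L
      Qm = poch q q m
      V = poch (pow Q L) q (s ℕ.+ s)
      g2 = pow q (s ℕ.+ s)
      Z1 = pow q ((s ℕ.+ s) ℕ.* ((s ℕ.+ s) ℕ.+ m))
      Z2 = pow q (reversalExponent (s ℕ.+ m) s)
      T2 = pow q (choose₂ (s ℕ.+ s))
      sg = pow (- 1#) s
      sg2 = pow (- 1#) (s ℕ.+ s)
      bs = pow b s
      qss = pow q (s ℕ.* s)
      Y = poch yᴸ P s
      R = poch (B * pow P m) P s

      reversal-q⁻ᴸ : V * Qm * Z1 ≈ sg2 * T2 * QL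
      reversal-q⁻ᴸ = poch-q⁻ᴸ-reversal (s ℕ.+ s) m

      reversal-b : Y * bs * Z2 ≈ sg * R
      reversal-b = begin
        Y * bs * Z2 ≡⟨ ≡.cong (λ j → poch (q²Q/b b b⁻¹ bb⁻¹≈1 j) P s * bs * Z2) (≡.cong (λ t → t ℕ.+ t) (regroup s m)) ⟩
        poch (q²Q/b b b⁻¹ bb⁻¹≈1 (((s ℕ.+ m) ℕ.+ s) ℕ.+ ((s ℕ.+ m) ℕ.+ s))) P s * bs * Z2 ≈⟨ poch-reversal b b⁻¹ bb⁻¹≈1 s (s ℕ.+ m) ⟩
        sg * poch (b * pow P (s ℕ.+ m)) P s ≈⟨ *-congˡ (poch-cong s (trans (*-congˡ (pow-+ P s m)) (sym (*-assoc _ _ _))) refl) ⟩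
        sg * R ∎
        where
        regroup : ∀ s m → s ℕ.+ s ℕ.+ m ≡ (s ℕ.+ m) ℕ.+ s
        regroup = ℕ-solve-∀

      exponents : g2 * Z2 * T2 ≈ qss * Z1
      exponents = begin
        g2 * Z2 * T2 ≈⟨ *-congʳ (sym (pow-+ q (s ℕ.+ s) (reversalExponent (s ℕ.+ m) s))) ⟩
        pow q ((s ℕ.+ s) ℕ.+ reversalExponent (s ℕ.+ m) s) * T2 ≈⟨ sym (pow-+ q ((s ℕ.+ s) ℕ.+ reversalExponent (s ℕ.+ m) s) (choose₂ (s ℕ.+ s))) ⟩
        pow q ((s ℕ.+ s) ℕ.+ reversalExponent (s ℕ.+ m) s ℕ.+ choose₂ (s ℕ.+ s)) ≡⟨ ≡.cong (pow q) (reversalExponent-even s m) ⟩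
        pow q (s ℕ.* s ℕ.+ (s ℕ.+ s) ℕ.* ((s ℕ.+ s) ℕ.+ m)) ≈⟨ pow-+ q (s ℕ.* s) ((s ℕ.+ s) ℕ.* ((s ℕ.+ s) ℕ.+ m)) ⟩
        qss * Z1 ∎

      reversal-core : R * V * g2 * Qm ≈ sg * bs * qss * QL * Y
      reversal-core = *-cancelʳ (*-≉0 (pow-≉0 ((s ℕ.+ s) ℕ.* ((s ℕ.+ s) ℕ.+ m)) q≉0) (pow-≉0 (reversalExponent (s ℕ.+ m) s) q≉0)) (begin
        R * V * g2 * Qm * (Z1 * Z2) ≈⟨ solve 6 (λ r v g m z1 z2 → r :* v :* g :* m :* (z1 :* z2) := (r :* g :* z2) :* (v :* m :* z1)) refl R V g2 Qm Z1 Z2 ⟩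
        (R * g2 * Z2) * (V * Qm * Z1) ≈⟨ *-congˡ reversal-q⁻ᴸ ⟩
        (R * g2 * Z2) * (sg2 * T2 * QL) ≈⟨ solve 6 (λ r g z2 s2 t ql → r :* g :* z2 :* (s2 :* t :* ql) := r :* s2 :* ql :* (g :* z2 :* t)) refl R g2 Z2 sg2 T2 QL ⟩
        R * sg2 * QL * (g2 * Z2 * T2) ≈⟨ *-cong (*-congʳ (*-congˡ (pow-+ (- 1#) s s))) exponents ⟩
        R * (sg * sg) * QL * (qss * Z1) ≈⟨ solve 7 (λ r s ql qs z1 b z2 → r :* (s :* s) :* ql :* (qs :* z1) := s :* qs :* ql :* z1 :* (s :* r)) refl R sg QL qss Z1 bs Z2 ⟩
        sg * qss * QL * Z1 * (sg * R) ≈⟨ *-congˡ (sym reversal-b) ⟩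
        sg * qss * QL * Z1 * (Y * bs * Z2) ≈⟨ solve 7 (λ s b qs ql y z1 z2 → s :* qs :* ql :* z1 :* (y :* b :* z2) := s :* b :* qs :* ql :* y :* (z1 :* z2)) refl sg bs qss QL Y Z1 Z2 ⟩
        sg * bs * qss * QL * Y * (Z1 * Z2) ∎)

      bPs BPm aqb Bqm AqPm bqPs aqPss aPPss Aqqm : Carrier
      bPs = poch b P s
      BPm = poch B P m
      aqb = poch ((a * q) ÷ b) P s
      Bqm = poch B q m
      AqPm = poch (A * q) P m
      bqPs = poch (b * q) P s
      aqPss = poch (a * q) P (s ℕ.+ s)
      aPPss = poch (a * P) P (s ℕ.+ s)
      Aqqm = poch (A * q) q m

      poch-b-P-L : poch b P L ≈ bPs * (BPm * R)
      poch-b-P-L = begin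
        poch b P L ≡⟨ ≡.cong (poch b P) (regroup s m) ⟩
        poch b P (s ℕ.+ (m ℕ.+ s)) ≈⟨ poch-+ b P s (m ℕ.+ s) ⟩
        bPs * poch B P (m ℕ.+ s) ≈⟨ *-congˡ (poch-+ B P m s) ⟩
        bPs * (BPm * R) ∎
        where
        regroup : ∀ s m → s ℕ.+ s ℕ.+ m ≡ s ℕ.+ (m ℕ.+ s)
        regroup = ℕ-solve-∀

      poch-b-q-L : poch b q L ≈ (bPs * bqPs) * Bqm
      poch-b-q-L = trans (poch-+ b q (s ℕ.+ s) m) (*-cong (poch-even-odd b q s) (poch-cong m (*-congˡ (sym (pow-square q s))) refl))

      poch-aq-P-L : poch (a * q) P L ≈ aqPss * AqPm
      poch-aq-P-L = trans (poch-+ (a * q) P (s ℕ.+ s) m) (*-congˡ (poch-cong m (solve 3 (λ a q t → a :* q :* t := a :* t :* q) refl a q (pow P (s ℕ.+ s))) refl))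

      weight-q-split : weight q L (s ℕ.+ s) ≈ Qm * ((aqPss * aPPss) * Aqqm)
      weight-q-split = begin
        poch q q (L ∸ (s ℕ.+ s)) * poch (a * q) q (L ℕ.+ (s ℕ.+ s))
          ≡⟨ ≡.cong₂ (λ u v → poch q q u * poch (a * q) q v) (ℕP.m+n∸m≡n (s ℕ.+ s) m) (regroup s m) ⟩
        Qm * poch (a * q) q (t ℕ.+ m) ≈⟨ *-congˡ (poch-+ (a * q) q t m) ⟩
        Qm * (poch (a * q) q t * poch (a * q * pow q t) q m)
          ≈⟨ *-congˡ (*-cong (trans (poch-even-odd (a * q) q (s ℕ.+ s)) (*-congˡ (poch-cong (s ℕ.+ s) (*-assoc _ _ _) refl)))
                             (poch-cong m (trans (*-congˡ (sym (pow-square q (s ℕ.+ s)))) (solve 3 (λ a q t → a :* q :* t := a :* t :* q) refl a q (pow P (s ℕ.+ s)))) refl)) ⟩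
        Qm * ((aqPss * aPPss) * Aqqm) ∎
        where
        t = (s ℕ.+ s) ℕ.+ (s ℕ.+ s)
        regroup : ∀ s m → s ℕ.+ s ℕ.+ m ℕ.+ (s ℕ.+ s) ≡ ((s ℕ.+ s) ℕ.+ (s ℕ.+ s)) ℕ.+ m
        regroup = ℕ-solve-∀

      cross-multiplied : (poch b P L * (Γ-num * (Bqm * AqPm))) * (bqPs * weight q L (s ℕ.+ s)) ≈ (sg * bs * qss * aqb) * ((QL * poch b q L * poch (a * q) P L) * (Γ-den * (BPm * Aqqm)))
      cross-multiplied = begin
        (poch b P L * (Γ-num * (Bqm * AqPm))) * (bqPs * weight q L (s ℕ.+ s)) ≈⟨ *-cong (*-congʳ poch-b-P-L) (*-congˡ weight-q-split) ⟩
        (bPs * (BPm * R)) * ((aqb * V * g2) * (Bqm * AqPm)) * (bqPs * (Qm * ((aqPss * aPPss) * Aqqm)))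
          ≈⟨ solve 13 (λ bPs BPm R aqb V g2 Bqm AqPm bqPs Qm aqPss aPPss Aqqm →
               (bPs :* (BPm :* R)) :* ((aqb :* V :* g2) :* (Bqm :* AqPm)) :* (bqPs :* (Qm :* ((aqPss :* aPPss) :* Aqqm)))
               := (bPs :* BPm :* aqb :* Bqm :* AqPm :* bqPs :* aqPss :* aPPss :* Aqqm) :* (R :* V :* g2 :* Qm)) refl
               bPs BPm R aqb V g2 Bqm AqPm bqPs Qm aqPss aPPss Aqqm ⟩
        (bPs * BPm * aqb * Bqm * AqPm * bqPs * aqPss * aPPss * Aqqm) * (R * V * g2 * Qm) ≈⟨ *-congˡ reversal-core ⟩
        (bPs * BPm * aqb * Bqm * AqPm * bqPs * aqPss * aPPss * Aqqm) * (sg * bs * qss * QL * Y)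
          ≈⟨ solve 14 (λ bPs BPm aqb Bqm AqPm bqPs aqPss aPPss Aqqm sg bs qss QL Y →
               (bPs :* BPm :* aqb :* Bqm :* AqPm :* bqPs :* aqPss :* aPPss :* Aqqm) :* (sg :* bs :* qss :* QL :* Y)
               := (sg :* bs :* qss :* aqb) :* ((QL :* ((bPs :* bqPs) :* Bqm) :* (aqPss :* AqPm)) :* ((Y :* aPPss) :* (BPm :* Aqqm)))) refl
               bPs BPm aqb Bqm AqPm bqPs aqPss aPPss Aqqm sg bs qss QL Y ⟩
        (sg * bs * qss * aqb) * ((QL * ((bPs * bqPs) * Bqm) * (aqPss * AqPm)) * ((Y * aPPss) * (BPm * Aqqm)))
          ≈⟨ *-congˡ (*-congʳ (sym (*-cong (*-congˡ poch-b-q-L) poch-aq-P-L))) ⟩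
        (sg * bs * qss * aqb) * ((QL * poch b q L * poch (a * q) P L) * (Γ-den * (BPm * Aqqm))) ∎

      weight-q≉0 : weight q L (s ℕ.+ s) ≉ 0#
      weight-q≉0 = *-≉0 (poch-q-q≉0 (L ∸ (s ℕ.+ s))) (poch-aq-q≉0 (L ℕ.+ (s ℕ.+ s)))

      prefactor·Γ·closedForm : prefactor L * (Γ * S.closedForm m) ≈ alphaFactor s * (weight q L (s ℕ.+ s)) ⁻¹
      prefactor·Γ·closedForm = begin
        prefactor L * (Γ * S.closedForm m) ≈⟨ *-congˡ (÷-*-÷ Γ-den≉0 (S.closedForm-denominator≉0 m)) ⟩
        prefactor L * ((Γ-num * (Bqm * AqPm)) ÷ (Γ-den * (BPm * Aqqm))) ≈⟨ ÷-*-÷ (*-≉0 (*-≉0 (poch-q-q≉0 L) (poch-b-q≉0 L)) (poch-aq-P≉0 L)) (*-≉0 Γ-den≉0 (S.closedForm-denominator≉0 m)) ⟩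
        (poch b P L * (Γ-num * (Bqm * AqPm))) ÷ ((QL * poch b q L * poch (a * q) P L) * (Γ-den * (BPm * Aqqm)))
          ≈⟨ ÷-≈-÷ (*-≉0 (*-≉0 (*-≉0 (poch-q-q≉0 L) (poch-b-q≉0 L)) (poch-aq-P≉0 L)) (*-≉0 Γ-den≉0 (S.closedForm-denominator≉0 m))) (*-≉0 (poch-bq-P≉0 s) weight-q≉0) cross-multiplied ⟩
        (sg * bs * qss * aqb) ÷ (bqPs * weight q L (s ℕ.+ s)) ≈⟨ sym (trans (*-assoc _ _ _) (*-congˡ (sym (⁻¹-distrib-* (poch-bq-P≉0 s) weight-q≉0)))) ⟩
        alphaFactor s * (weight q L (s ℕ.+ s)) ⁻¹ ∎

      inner-sum-at : InnerSum L s
      inner-sum-at = begin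
        prefactor L * sumTo (⌊ L /2⌋ ∸ s) (λ k → coefficient L (s ℕ.+ k) * (weight P (s ℕ.+ k) s) ⁻¹)
          ≡⟨ ≡.cong (λ n → prefactor L * sumTo n (λ k → coefficient L (s ℕ.+ k) * (weight P (s ℕ.+ k) s) ⁻¹)) (≡.trans (≡.cong (_∸ s) (⌊2s+m/2⌋≡s+⌊m/2⌋ s m)) (ℕP.m+n∸m≡n s ⌊ m /2⌋)) ⟩
        prefactor L * sumTo ⌊ m /2⌋ (λ k → coefficient L (s ℕ.+ k) * (weight P (s ℕ.+ k) s) ⁻¹) ≈⟨ *-congˡ (sumTo-cong ⌊ m /2⌋ coefficient≈Γ·summand) ⟩
        prefactor L * sumTo ⌊ m /2⌋ (λ k → Γ * S.summand x k) ≈⟨ *-congˡ (sym (sumTo-*ˡ ⌊ m /2⌋ Γ (S.summand x))) ⟩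
        prefactor L * (Γ * sumTo ⌊ m /2⌋ (S.summand x)) ≈⟨ *-congˡ (*-congˡ (S.summation m)) ⟩
        prefactor L * (Γ * S.closedForm m) ≈⟨ prefactor·Γ·closedForm ⟩
        alphaFactor s * (weight q L (s ℕ.+ s)) ⁻¹ ∎

    inner-sum : ∀ L s → s ≤ ⌊ L /2⌋ → InnerSum L s
    inner-sum L s s≤⌊L/2⌋ = ≡.subst (λ t → InnerSum t s) (ℕP.m+[n∸m]≡n 2s≤L) (InnerSumAt.inner-sum-at s (L ∸ (s ℕ.+ s)))
      where
      2s≤L : s ℕ.+ s ≤ L
      2s≤L = ℕP.≤-trans (ℕP.+-mono-≤ s≤⌊L/2⌋ (ℕP.≤-trans s≤⌊L/2⌋ (ℕP.⌊n/2⌋≤⌈n/2⌉ L))) (ℕP.≤-reflexive (ℕP.⌊n/2⌋+⌈n/2⌉≡n L))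

    bailey-pair : (α β : ℕ → Carrier) → IsBaileyPair a P α β → IsBaileyPair a q (alpha' a b q α) (beta' a b q β)
    bailey-pair α β bailey L = begin
      beta' a b q β L
        ≈⟨ *-congˡ (sumTo-cong M (λ r _ → *-congˡ (bailey r))) ⟩
      prefactor L * sumTo M (λ r → coefficient L r * sumTo r (λ s → α s ÷ weight P r s))
        ≈⟨ *-congˡ (sumTo-cong M (λ r _ → sumTo-*ˡ r (coefficient L r) (λ s → α s ÷ weight P r s))) ⟩
      prefactor L * sumTo M (λ r → sumTo r (λ s → coefficient L r * (α s ÷ weight P r s)))
        ≈⟨ *-congˡ (sumTo-triangle-swap M (λ r s → coefficient L r * (α s ÷ weight P r s))) ⟩
      prefactor L * sumTo M (λ s → sumTo (M ∸ s) (λ k → coefficient L (s ℕ.+ k) * (α s ÷ weight P (s ℕ.+ k) s)))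
        ≈⟨ sumTo-*ˡ M (prefactor L) _ ⟩
      sumTo M (λ s → prefactor L * sumTo (M ∸ s) (λ k → coefficient L (s ℕ.+ k) * (α s ÷ weight P (s ℕ.+ k) s)))
        ≈⟨ sumTo-cong M coefficient-of-α ⟩
      sumTo M (λ s → (alphaFactor s * α s) * (weight q L (s ℕ.+ s)) ⁻¹)
        ≈⟨ sym (sumTo-interleave L (λ s → alphaFactor s * α s) (λ n → (weight q L n) ⁻¹)) ⟩
      sumTo L (λ n → alpha' a b q α n ÷ weight q L n) ∎
      where
      M = ⌊ L /2⌋
      coefficient-of-α : ∀ s → s ≤ M →
        prefactor L * sumTo (M ∸ s) (λ k → coefficient L (s ℕ.+ k) * (α s ÷ weight P (s ℕ.+ k) s))
          ≈ (alphaFactor s * α s) * (weight q L (s ℕ.+ s)) ⁻¹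
      coefficient-of-α s s≤M = begin
        prefactor L * sumTo (M ∸ s) (λ k → coefficient L (s ℕ.+ k) * (α s * (weight P (s ℕ.+ k) s) ⁻¹))
          ≈⟨ *-congˡ (sumTo-cong (M ∸ s) (λ k _ → x∙yz≈y∙xz _ _ _)) ⟩
        prefactor L * sumTo (M ∸ s) (λ k → α s * (coefficient L (s ℕ.+ k) * (weight P (s ℕ.+ k) s) ⁻¹))
          ≈⟨ *-congˡ (sym (sumTo-*ˡ (M ∸ s) (α s) _)) ⟩
        prefactor L * (α s * sumTo (M ∸ s) (λ k → coefficient L (s ℕ.+ k) * (weight P (s ℕ.+ k) s) ⁻¹))
          ≈⟨ x∙yz≈y∙xz _ _ _ ⟩
        α s * (prefactor L * sumTo (M ∸ s) (λ k → coefficient L (s ℕ.+ k) * (weight P (s ℕ.+ k) s) ⁻¹))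
          ≈⟨ *-congˡ (inner-sum L s s≤M) ⟩
        α s * (alphaFactor s * (weight q L (s ℕ.+ s)) ⁻¹)
          ≈⟨ sym (*-assoc _ _ _) ⟩
        (α s * alphaFactor s) * (weight q L (s ℕ.+ s)) ⁻¹
          ≈⟨ *-congʳ (*-comm _ _) ⟩
        (alphaFactor s * α s) * (weight q L (s ℕ.+ s)) ⁻¹ ∎

lemma5p4 : ∀ {c ℓ} (F : Field c ℓ) → let open Field F in let open FieldDefs F in
    (a b q : Carrier) → Generic a b q →
    (α β : ℕ → Carrier) → IsBaileyPair a (q * q) α β →
    IsBaileyPair a q (alpha' a b q α) (beta' a b q β)
lemma5p4 F a b q generic = Transformation.bailey-pair F a b q generic
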